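{- Let $M$ be a loopless matroid of rank $n$ with lattice of flats $\mathcal{L}(M)$, and let $\lambda$ be an $R$-labeling of $\mathcal{L}(M)$ with nonnegative integer values. Then the augmented Chow polynomial of $M$ satisfies \[ \mathsf{H}_M(x) = \sum_{\mathcal{F}} x^{\mathsf{des}(\mathcal{F})} (x+1)^{n-2\,\mathsf{des}(\mathcal{F})}, \] where the sum ranges over all maximal chains $\mathcal{F}$ in $\mathcal{L}(M)$ such that $\mathsf{Des}(\mathcal{F})$ is isolated.
   Context: For a finite graded poset $P$ of rank $n$ (unique minimum $\hat 0$, unique maximum $\hat 1$), with Möbius function $\mu$, the characteristic polynomial is $\chi_P(q) = \sum_{F \in P} \mu(\hat 0, F) q^{n - \mathsf{rank}(F)}$ and the reduced characteristic polynomial is $\overline{\chi}_P(q) = \chi_P(q)/(q-1)$ (for $n \ge 1$). For a chain $\mathcal{C} = \{\mathcal{C}_1 < \dots < \mathcal{C}_{k+1}\}$ set $\overline{\chi}_{P,\mathcal{C}}(q) = \prod_{i=1}^k \overline{\chi}_{[\mathcal{C}_i, \mathcal{C}_{i+1}]}(q)$ (empty product $=1$). The augmented Chow polynomial $\mathsf{H}_M(x)$ of $M$ is the Hilbert–Poincaré series of the augmented Chow ring of $M$; equivalently, with $P = \mathcal{L}(M)$, it is $1$ if $n = 0$ and otherwise equals $\sum_{\mathcal{C}} x^{\mathsf{rank}(\mathcal{C}_1)} \overline{\chi}_{P,\mathcal{C}}(x)$, the sum over all chains $\mathcal{C} = \{\mathcal{C}_1 < \dots < \mathcal{C}_{k+1}\}$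 ($k \geq 0$) in $P$ with $\mathcal{C}_{k+1} = \hat 1$. An $R$-labeling of a finite graded poset is a labeling $\lambda$ of its cover relations such that every interval contains a unique maximal chain along which the labels are weakly increasing. For a maximal chain $\mathcal{F} = \{\mathcal{F}_0 \prec \dots \prec \mathcal{F}_n\}$ put $\lambda_i = \lambda(\mathcal{F}_{i-1} \prec \mathcal{F}_i)$, $\mathsf{Des}(\mathcal{F}) = \{ i \in \{1,\dots,n-1\} \mid \lambda_i > \lambda_{i+1}\}$ and $\mathsf{des}(\mathcal{F}) = |\mathsf{Des}(\mathcal{F})|$. The set $\mathsf{Des}(\mathcal{F})$ is called isolated if $i \in \mathsf{Des}(\mathcal{F})$ implies $i+1 \notin \mathsf{Des}(\mathcal{F})$. -}

module Defs where

open import Data.Bool using (Bool; true; false; _∧_; _∨_; not; if_then_else_; T)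
open import Data.Nat as ℕ using (ℕ; zero; suc; _≤_; _∸_; _≤ᵇ_; _<ᵇ_; _≡ᵇ_)
open import Data.Nat.Properties using ()
open import Data.Integer as ℤ using (ℤ; 0ℤ; 1ℤ)
open import Data.Fin using (Fin)
open import Data.Fin.Subset using (Subset; _⊆_; _∪_; _∩_; ⁅_⁆; ⊥; ⊤; ∣_∣; inside; outside)
open import Data.Fin.Subset.Properties using (_⊆?_)
open import Data.Vec using (Vec; []; _∷_; lookup)
open import Data.Vec.Properties using (≡-dec)
open import Data.List as L using (List; []; _∷_; map; filter; concatMap; allFin; foldr; replicate; _++_)
open import Data.List.Membership.Propositional using (_∈_)
open import Data.Product using (Σ; ∃; ∃-syntax; _×_; _,_)
open import Relation.Nullary.Decidable using (isYes; does)
open import Relation.Binary.PropositionalEquality using (_≡_)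
import Data.Bool.Properties as BoolP

-- Polynomials with integer coefficients, as ascending coefficient lists
-- (p = a₀ ∷ a₁ ∷ … represents a₀ + a₁ x + …; trailing zeros allowed).

Poly : Set
Poly = List ℤ

_+ₚ_ : Poly → Poly → Poly
[] +ₚ q = q
(a ∷ p) +ₚ [] = a ∷ p
(a ∷ p) +ₚ (b ∷ q) = (a ℤ.+ b) ∷ (p +ₚ q)

_*ₚ_ : Poly → Poly → Poly
[] *ₚ q = []
(a ∷ p) *ₚ q = map (a ℤ.*_) q +ₚ (0ℤ ∷ (p *ₚ q))

oneₚ : Poly
oneₚ = 1ℤ ∷ []

monoₚ : ℤ → ℕ → Poly
monoₚ c k = replicate k 0ℤ ++ (c ∷ [])

Xₚ X+1ₚ : Poly
Xₚ = monoₚ 1ℤ 1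
X+1ₚ = 1ℤ ∷ 1ℤ ∷ []

_^ₚ_ : Poly → ℕ → Poly
p ^ₚ zero = oneₚ
p ^ₚ suc k = p *ₚ (p ^ₚ k)

sumₚ : List Poly → Poly
sumₚ = foldr _+ₚ_ []

prodₚ : List Poly → Poly
prodₚ = foldr _*ₚ_ oneₚ

-- exact quotient of p by (x - 1) (synthetic division; the remainder,
-- which is zero whenever (x - 1) divides p, is discarded)
-- quotient coefficient bᵢ = -(a₀ + … + aᵢ) for i < deg
div-acc : ℤ → Poly → Poly
div-acc s [] = []
div-acc s (b ∷ p) = (ℤ.- s) ∷ div-acc (s ℤ.+ b) p

div-x-1 : Poly → Poly
div-x-1 [] = []
div-x-1 (a ∷ p) = div-acc a p

coeff : Poly → ℕ → ℤ
coeff [] k = 0ℤ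
coeff (a ∷ p) zero = a
coeff (a ∷ p) (suc k) = coeff p k

_≈ₚ_ : Poly → Poly → Set
p ≈ₚ q = ∀ k → coeff p k ≡ coeff q k

record Matroid (m : ℕ) : Set where
  field
    r       : Subset m → ℕ
    r-bound : ∀ X → r X ≤ ∣ X ∣
    r-mono  : ∀ X Y → X ⊆ Y → r X ≤ r Y
    r-submod : ∀ X Y → r (X ∪ Y) ℕ.+ r (X ∩ Y) ≤ r X ℕ.+ r Y

Loopless : ∀ {m} → Matroid m → Set
Loopless {m} M = ∀ (e : Fin m) → Matroid.r M ⁅ e ⁆ ≡ 1

rank : ∀ {m} → Matroid m → ℕ
rank M = Matroid.r M ⊤

allSubsets : (m : ℕ) → List (Subset m)
allSubsets zero = [] ∷ []
allSubsets (suc m) = map (outside ∷_) (allSubsets m) ++ map (inside ∷_) (allSubsets m)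

_⊆ᵇ_ : ∀ {m} → Subset m → Subset m → Bool
X ⊆ᵇ Y = isYes (X ⊆? Y)

_=ˢ_ : ∀ {m} → Subset m → Subset m → Bool
X =ˢ Y = isYes (≡-dec BoolP._≟_ X Y)

_⊂ᵇ_ : ∀ {m} → Subset m → Subset m → Bool
X ⊂ᵇ Y = (X ⊆ᵇ Y) ∧ not (X =ˢ Y)

anyL allL : ∀ {A : Set} → (A → Bool) → List A → Bool
anyL p = foldr (λ a b → p a ∨ b) false
allL p = foldr (λ a b → p a ∧ b) true

module LatticeOfFlats {m : ℕ} (M : Matroid m) where
  open Matroid M

  isFlat : Subset m → Bool
  isFlat X = allL (λ e → lookup X e ∨ (r X <ᵇ r (X ∪ ⁅ e ⁆))) (allFin m)

  -- the elements of the lattice of flats L(M), ordered by inclusion;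
  -- 0̂ = ⊥ (the empty set, a flat as M is loopless), 1̂ = ⊤ (ground set)
  flats : List (Subset m)
  flats = filter (λ X → T? (isFlat X)) (allSubsets m)
    where
    open import Relation.Nullary.Decidable using (Dec)
    T? : (b : Bool) → Dec (T b)
    T? = Data.Bool.T?
      where import Data.Bool

  rk : Subset m → ℕ
  rk = r

  interval : Subset m → Subset m → List (Subset m)
  interval x y = filter (λ z → T? ((x ⊆ᵇ z) ∧ (z ⊆ᵇ y))) flats
    where
    T? = Data.Bool.T?
      where import Data.Bool

  covers : Subset m → Subset m → Bool
  covers x y = isFlat x ∧ isFlat y ∧ (x ⊂ᵇ y)
             ∧ not (anyL (λ z → (x ⊂ᵇ z) ∧ (z ⊂ᵇ y)) flats)

  -- Möbius function μ(x , y) of L(M), computed with a fuel parameter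
  -- (fuel suc m suffices since chains of flats have length ≤ m)
  μ′ : ℕ → Subset m → Subset m → ℤ
  μ′ zero x y = 0ℤ
  μ′ (suc f) x y =
    if x =ˢ y then 1ℤ
    else if x ⊆ᵇ y
      then ℤ.- L.foldr ℤ._+_ 0ℤ
             (map (μ′ f x) (L.filter (λ z → Data.Bool.T? (not (z =ˢ y))) (interval x y)))
      else 0ℤ
    where import Data.Bool

  μ : Subset m → Subset m → ℤ
  μ = μ′ (suc m)

  χ : Subset m → Subset m → Poly
  χ x y = sumₚ (map (λ F → monoₚ (μ x F) (rk y ∸ rk F)) (interval x y))

  χ̄ : Subset m → Subset m → Poly
  χ̄ x y = div-x-1 (χ x y)

  chainsFrom′ : ℕ → Subset m → List (List (Subset m))
  chainsFrom′ zero x = []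
  chainsFrom′ (suc f) x =
    if x =ˢ ⊤ then (x ∷ []) ∷ []
    else concatMap (λ y → map (x ∷_) (chainsFrom′ f y))
                   (L.filter (λ y → Data.Bool.T? (x ⊂ᵇ y)) flats)
    where import Data.Bool

  chainsTo1 : List (List (Subset m))
  chainsTo1 = concatMap (chainsFrom′ (suc m)) flats

  χ̄-chain : List (Subset m) → Poly
  χ̄-chain (a ∷ b ∷ c) = χ̄ a b *ₚ χ̄-chain (b ∷ c)
  χ̄-chain _ = oneₚ

  firstRank : List (Subset m) → ℕ
  firstRank [] = 0
  firstRank (a ∷ _) = rk a

  augChow : Poly
  augChow = if rank M ≡ᵇ 0 then oneₚ
            else sumₚ (map (λ C → (Xₚ ^ₚ firstRank C) *ₚ χ̄-chain C) chainsTo1)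

  satChains′ : ℕ → Subset m → Subset m → List (List (Subset m))
  satChains′ zero x y = []
  satChains′ (suc f) x y =
    if x =ˢ y then (x ∷ []) ∷ []
    else concatMap (λ z → map (x ∷_) (satChains′ f z y))
                   (L.filter (λ z → Data.Bool.T? (covers x z ∧ (z ⊆ᵇ y))) flats)
    where import Data.Bool

  satChains : Subset m → Subset m → List (List (Subset m))
  satChains = satChains′ (suc m)

  maxChains : List (List (Subset m))
  maxChains = satChains ⊥ ⊤

  labels : (Subset m → Subset m → ℕ) → List (Subset m) → List ℕ
  labels lab (a ∷ b ∷ c) = lab a b ∷ labels lab (b ∷ c)
  labels lab _ = []

  weaklyIncreasing : List ℕ → Bool
  weaklyIncreasing (a ∷ b ∷ l) = (a ≤ᵇ b) ∧ weaklyIncreasing (b ∷ l)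
  weaklyIncreasing _ = true

  IsRLabeling : (Subset m → Subset m → ℕ) → Set
  IsRLabeling lab =
    ∀ x y → x ∈ flats → y ∈ flats → x ⊆ y →
      ∃[ c ] ((c ∈ satChains x y × T (weaklyIncreasing (labels lab c)))
             × (∀ c′ → c′ ∈ satChains x y → T (weaklyIncreasing (labels lab c′)) → c′ ≡ c))

  -- descent indicator list: entry i (1 ≤ i ≤ k-1) is true iff λᵢ > λᵢ₊₁
  descents : List ℕ → List Bool
  descents (a ∷ b ∷ l) = (b <ᵇ a) ∷ descents (b ∷ l)
  descents _ = []

  count : List Bool → ℕ
  count [] = 0
  count (true ∷ l) = suc (count l)
  count (false ∷ l) = count l

  isolated : List Bool → Bool
  isolated (true ∷ true ∷ l) = false
  isolated (a ∷ l) = isolated l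
  isolated [] = true

  des : (Subset m → Subset m → ℕ) → List (Subset m) → ℕ
  des lab F = count (descents (labels lab F))

  DesIsolated : (Subset m → Subset m → ℕ) → List (Subset m) → Bool
  DesIsolated lab F = isolated (descents (labels lab F))

  rhs : (Subset m → Subset m → ℕ) → Poly
  rhs lab = sumₚ (map (λ F → (Xₚ ^ₚ des lab F) *ₚ (X+1ₚ ^ₚ (rank M ∸ 2 ℕ.* des lab F)))
                      (L.filter (λ F → Data.Bool.T? (DesIsolated lab F)) maxChains))
    where import Data.Bool

-- Everything is reduced to the label words of maximal chains. Since λ is an R-labeling,
-- each interval [F , b] has exactly one weakly increasing maximal chain, so x ^ (rk b - rk F)
-- is a sum over its chains, and μ(a , F) is the signed number of strictly decreasing chains
-- of [a , F]. Hence every maximal chain of [a , b] contributes to χ_[a,b] the sum, over the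
-- ways of cutting its label word into a decreasing and an increasing part, of the two
-- weights; this telescopes to (x - 1) times a "valley" weight, so χ̄_[a,b] sums the valley
-- weights of the maximal chains. Substituting into the chain formula for H_M, the chains
-- ⊥ < C₁ < … < ⊤ glue with the chains of the intervals into maximal chains of L(M), and
-- H_M becomes a sum over maximal chains of the weight "increasing prefix, then a
-- factorisation into valleys" of the label word. A letter-by-letter recursion shows that
-- this weight is x ^ des (x + 1) ^ (n - 2 des) if the descents are isolated and 0 otherwise.
module Submission where

open import Defs
open import Algebra.Bundles using (CommutativeRing)
open import Data.Nat using (ℕ)
open import Data.Fin.Subset using (Subset)

module ListSums {c ℓ} (R : CommutativeRing c ℓ) where
  open CommutativeRing R
  open import Level using (Level)
  open import Data.Bool using (Bool; true; false; if_then_else_)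
  open import Data.List using (List; []; _∷_; map; _++_; concatMap; filter; foldr)
  open import Data.List.Membership.Propositional using (_∈_)
  open import Data.List.Relation.Unary.Any using (here; there)
  open import Data.List.Relation.Unary.All using (lookup)
  open import Data.List.Relation.Unary.Unique.Propositional using (Unique; _∷_)
  open import Relation.Binary.PropositionalEquality as ≡ using (_≡_; _≢_)
  open import Algebra.Properties.Ring ring using (-‿distribˡ-*; -‿+-comm)
  open import Relation.Binary.Reasoning.Setoid setoid
  import Data.Bool

  private variable
    a b : Level
    A : Set a
    B : Set b

  ∑ : List A → (A → Carrier) → Carrier
  ∑ []       f = 0#
  ∑ (x ∷ xs) f = f x + ∑ xs f

  syntax ∑ xs (λ x → e) = ∑[ x ∈ xs ] e

  ∑-cong-∈ : ∀ (xs : List A) {f g} → (∀ x → x ∈ xs → f x ≈ g x) → ∑ xs f ≈ ∑ xs g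
  ∑-cong-∈ []       f≈g = refl
  ∑-cong-∈ (x ∷ xs) f≈g = +-cong (f≈g x (here ≡.refl)) (∑-cong-∈ xs λ y y∈xs → f≈g y (there y∈xs))

  ∑-cong : ∀ (xs : List A) {f g} → (∀ x → f x ≈ g x) → ∑ xs f ≈ ∑ xs g
  ∑-cong xs f≈g = ∑-cong-∈ xs λ x _ → f≈g x

  ∑-++ : ∀ (xs ys : List A) f → ∑ (xs ++ ys) f ≈ ∑ xs f + ∑ ys f
  ∑-++ []       ys f = sym (+-identityˡ _)
  ∑-++ (x ∷ xs) ys f = trans (+-congˡ (∑-++ xs ys f)) (sym (+-assoc _ _ _))

  ∑-vanish : ∀ (xs : List A) f → (∀ x → x ∈ xs → f x ≈ 0#) → ∑ xs f ≈ 0#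
  ∑-vanish []       f f≈0 = refl
  ∑-vanish (x ∷ xs) f f≈0 =
    trans (+-cong (f≈0 x (here ≡.refl)) (∑-vanish xs f λ y y∈xs → f≈0 y (there y∈xs))) (+-identityˡ 0#)

  ∑-+ : ∀ (xs : List A) f g → ∑[ x ∈ xs ] (f x + g x) ≈ ∑ xs f + ∑ xs g
  ∑-+ []       f g = sym (+-identityˡ 0#)
  ∑-+ (x ∷ xs) f g = begin
    (f x + g x) + ∑[ y ∈ xs ] (f y + g y)  ≈⟨ +-congˡ (∑-+ xs f g) ⟩
    (f x + g x) + (∑ xs f + ∑ xs g)        ≈⟨ +-assoc (f x) (g x) _ ⟩
    f x + (g x + (∑ xs f + ∑ xs g))        ≈⟨ +-congˡ (x+[y+z]≈y+[x+z] (g x) (∑ xs f) (∑ xs g)) ⟩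
    f x + (∑ xs f + (g x + ∑ xs g))        ≈⟨ +-assoc (f x) (∑ xs f) _ ⟨
    (f x + ∑ xs f) + (g x + ∑ xs g)        ∎
    where
    x+[y+z]≈y+[x+z] : ∀ x y z → x + (y + z) ≈ y + (x + z)
    x+[y+z]≈y+[x+z] x y z =
      trans (sym (+-assoc x y z)) (trans (+-congʳ (+-comm x y)) (+-assoc y x z))

  *-distribˡ-∑ : ∀ k (xs : List A) f → k * ∑ xs f ≈ ∑[ x ∈ xs ] (k * f x)
  *-distribˡ-∑ k []       f = zeroʳ k
  *-distribˡ-∑ k (x ∷ xs) f = trans (distribˡ k _ _) (+-congˡ (*-distribˡ-∑ k xs f))

  *-distribʳ-∑ : ∀ k (xs : List A) f → ∑ xs f * k ≈ ∑[ x ∈ xs ] (f x * k)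
  *-distribʳ-∑ k xs f =
    trans (*-comm _ k) (trans (*-distribˡ-∑ k xs f) (∑-cong xs λ x → *-comm k (f x)))

  ∑-filter : ∀ (p : A → Bool) (xs : List A) f →
             ∑ (filter (λ x → Data.Bool.T? (p x)) xs) f ≈ ∑[ x ∈ xs ] (if p x then f x else 0#)
  ∑-filter p []       f = refl
  ∑-filter p (x ∷ xs) f with p x
  ... | true  = +-congˡ (∑-filter p xs f)
  ... | false = trans (∑-filter p xs f) (sym (+-identityˡ _))

  ∑-single : ∀ (xs : List A) x₀ f → Unique xs → x₀ ∈ xs →
             (∀ x → x ∈ xs → x ≢ x₀ → f x ≈ 0#) → ∑ xs f ≈ f x₀
  ∑-single (x ∷ xs) x₀ f (x∉xs ∷ _) (here ≡.refl) f≈0 =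
    trans (+-congˡ (∑-vanish xs f λ y y∈xs → f≈0 y (there y∈xs) λ where ≡.refl → lookup x∉xs y∈xs ≡.refl))
          (+-identityʳ _)
  ∑-single (x ∷ xs) x₀ f (x∉xs ∷ xs!) (there x₀∈xs) f≈0 =
    trans (+-cong (f≈0 x (here ≡.refl) λ where ≡.refl → lookup x∉xs x₀∈xs ≡.refl)
                  (∑-single xs x₀ f xs! x₀∈xs λ y y∈xs → f≈0 y (there y∈xs)))
          (+-identityˡ _)

  ∑-map : ∀ (g : A → B) (xs : List A) f → ∑ (map g xs) f ≡ ∑[ x ∈ xs ] f (g x)
  ∑-map g []       f = ≡.refl
  ∑-map g (x ∷ xs) f = ≡.cong (f (g x) +_) (∑-map g xs f)

  foldr-+-map : ∀ (f : A → Carrier) xs → foldr _+_ 0# (map f xs) ≡ ∑ xs f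
  foldr-+-map f []       = ≡.refl
  foldr-+-map f (x ∷ xs) = ≡.cong (f x +_) (foldr-+-map f xs)

  ∑-concatMap : ∀ (g : A → List B) (xs : List A) f → ∑ (concatMap g xs) f ≈ ∑[ x ∈ xs ] ∑ (g x) f
  ∑-concatMap g []       f = refl
  ∑-concatMap g (x ∷ xs) f = trans (∑-++ (g x) _ f) (+-congˡ (∑-concatMap g xs f))

  ∑-comm : ∀ (xs : List A) (ys : List B) (f : A → B → Carrier) →
           ∑[ x ∈ xs ] ∑[ y ∈ ys ] f x y ≈ ∑[ y ∈ ys ] ∑[ x ∈ xs ] f x y
  ∑-comm []       ys f = sym (∑-vanish ys _ λ _ _ → refl)
  ∑-comm (x ∷ xs) ys f = trans (+-congˡ (∑-comm xs ys f)) (sym (∑-+ ys (f x) _))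

  -- (g ⋆ h) w sums g u * h v over all factorisations w = u ++ v.
  infixl 7 _⋆_
  _⋆_ : (List A → Carrier) → (List A → Carrier) → List A → Carrier
  (g ⋆ h) []      = g [] * h []
  (g ⋆ h) (x ∷ w) = g [] * h (x ∷ w) + ((λ u → g (x ∷ u)) ⋆ h) w

  ⋆-zeroˡ : ∀ (h : List A → Carrier) w → ((λ _ → 0#) ⋆ h) w ≈ 0#
  ⋆-zeroˡ h []      = zeroˡ _
  ⋆-zeroˡ h (x ∷ w) = trans (+-cong (zeroˡ _) (⋆-zeroˡ h w)) (+-identityˡ 0#)

  ⋆-negˡ : ∀ (g h : List A → Carrier) w → ((λ u → - g u) ⋆ h) w ≈ - (g ⋆ h) w
  ⋆-negˡ g h []      = sym (-‿distribˡ-* _ _)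
  ⋆-negˡ g h (x ∷ w) =
    trans (+-cong (sym (-‿distribˡ-* _ _)) (⋆-negˡ (λ u → g (x ∷ u)) h w)) (-‿+-comm _ _)

  ⋆-*ˡ : ∀ k (g h : List A → Carrier) w → ((λ u → k * g u) ⋆ h) w ≈ k * (g ⋆ h) w
  ⋆-*ˡ k g h []      = *-assoc _ _ _
  ⋆-*ˡ k g h (x ∷ w) =
    trans (+-cong (*-assoc _ _ _) (⋆-*ˡ k (λ u → g (x ∷ u)) h w)) (sym (distribˡ _ _ _))

  if-cong : ∀ b {x y} → x ≈ y → (if b then x else 0#) ≈ (if b then y else 0#)
  if-cong true  x≈y = x≈y
  if-cong false _   = refl

  *-if : ∀ k b x → k * (if b then x else 0#) ≈ (if b then k * x else 0#)
  *-if k true  x = refl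
  *-if k false x = zeroʳ k

  if-* : ∀ b x k → (if b then x else 0#) * k ≈ (if b then x * k else 0#)
  if-* true  x k = refl
  if-* false x k = zeroˡ k

module PolynomialRing where
  open import Data.Nat using (zero; suc)
  open import Data.Integer using (ℤ; 0ℤ; 1ℤ; _+_; _*_; -_)
  import Data.Integer.Properties as ℤ
  open import Data.Integer.Solver using (module +-*-Solver)
  open import Data.List using (List; []; _∷_; map)
  open import Data.Product using (_,_)
  open import Relation.Binary.PropositionalEquality
  open +-*-Solver using (solve; _:+_; _:*_; _:=_)

  -- A record around _≈ₚ_, so that Agda can recover both polynomials from an equation.
  infix 4 _≋_
  record _≋_ (p q : Poly) : Set where
    constructor mk≋
    field coeff-≡ : p ≈ₚ q
  open _≋_ public

  infixr 25 _·_
  _·_ : ℤ → Poly → Poly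
  a · q = map (a *_) q

  negₚ : Poly → Poly
  negₚ = map -_

  coeff-+ₚ : ∀ p q k → coeff (p +ₚ q) k ≡ coeff p k + coeff q k
  coeff-+ₚ []      q       k       = sym (ℤ.+-identityˡ _)
  coeff-+ₚ (a ∷ p) []      k       = sym (ℤ.+-identityʳ _)
  coeff-+ₚ (a ∷ p) (b ∷ q) zero    = refl
  coeff-+ₚ (a ∷ p) (b ∷ q) (suc k) = coeff-+ₚ p q k

  coeff-· : ∀ a q k → coeff (a · q) k ≡ a * coeff q k
  coeff-· a []      k       = sym (ℤ.*-zeroʳ a)
  coeff-· a (b ∷ q) zero    = refl
  coeff-· a (b ∷ q) (suc k) = coeff-· a q k

  coeff-negₚ : ∀ q k → coeff (negₚ q) k ≡ - coeff q k
  coeff-negₚ []      k       = refl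
  coeff-negₚ (b ∷ q) zero    = refl
  coeff-negₚ (b ∷ q) (suc k) = coeff-negₚ q k

  ≋-refl : ∀ {p} → p ≋ p
  ≋-refl = mk≋ λ _ → refl

  ≋-reflexive : ∀ {p q} → p ≡ q → p ≋ q
  ≋-reflexive refl = ≋-refl

  ≋-sym : ∀ {p q} → p ≋ q → q ≋ p
  ≋-sym (mk≋ e) = mk≋ λ k → sym (e k)

  ≋-trans : ∀ {p q r} → p ≋ q → q ≋ r → p ≋ r
  ≋-trans (mk≋ e) (mk≋ f) = mk≋ λ k → trans (e k) (f k)

  ∷-cong : ∀ {p q} a → p ≋ q → (a ∷ p) ≋ (a ∷ q)
  ∷-cong a (mk≋ e) = mk≋ λ where
    zero    → refl
    (suc k) → e k

  +ₚ-cong : ∀ {p p′ q q′} → p ≋ p′ → q ≋ q′ → (p +ₚ q) ≋ (p′ +ₚ q′)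
  +ₚ-cong {p} {p′} {q} {q′} (mk≋ e) (mk≋ f) = mk≋ λ k →
    trans (coeff-+ₚ p q k) (trans (cong₂ _+_ (e k) (f k)) (sym (coeff-+ₚ p′ q′ k)))

  negₚ-cong : ∀ {p q} → p ≋ q → negₚ p ≋ negₚ q
  negₚ-cong {p} {q} (mk≋ e) = mk≋ λ k →
    trans (coeff-negₚ p k) (trans (cong -_ (e k)) (sym (coeff-negₚ q k)))

  +ₚ-identityʳ : ∀ p → (p +ₚ []) ≋ p
  +ₚ-identityʳ []      = ≋-refl
  +ₚ-identityʳ (a ∷ p) = ≋-refl

  +ₚ-comm : ∀ p q → (p +ₚ q) ≋ (q +ₚ p)
  +ₚ-comm p q = mk≋ λ k →
    trans (coeff-+ₚ p q k) (trans (ℤ.+-comm (coeff p k) (coeff q k)) (sym (coeff-+ₚ q p k)))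

  +ₚ-assoc : ∀ p q r → ((p +ₚ q) +ₚ r) ≋ (p +ₚ (q +ₚ r))
  +ₚ-assoc p q r = mk≋ λ k → begin
    coeff ((p +ₚ q) +ₚ r) k                   ≡⟨ coeff-+ₚ (p +ₚ q) r k ⟩
    coeff (p +ₚ q) k + coeff r k              ≡⟨ cong (_+ coeff r k) (coeff-+ₚ p q k) ⟩
    (coeff p k + coeff q k) + coeff r k       ≡⟨ ℤ.+-assoc (coeff p k) (coeff q k) (coeff r k) ⟩
    coeff p k + (coeff q k + coeff r k)       ≡⟨ cong (coeff p k +_) (coeff-+ₚ q r k) ⟨
    coeff p k + coeff (q +ₚ r) k              ≡⟨ coeff-+ₚ p (q +ₚ r) k ⟨
    coeff (p +ₚ (q +ₚ r)) k                   ∎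
    where open ≡-Reasoning

  +ₚ-inverseʳ : ∀ p → (p +ₚ negₚ p) ≋ []
  +ₚ-inverseʳ p = mk≋ λ k →
    trans (coeff-+ₚ p (negₚ p) k) (trans (cong (coeff p k +_) (coeff-negₚ p k)) (ℤ.+-inverseʳ (coeff p k)))

  *ₚ-zeroˡ : ∀ p q → p ≈ₚ [] → (p *ₚ q) ≈ₚ []
  *ₚ-zeroˡ []      q p≈0 k = refl
  *ₚ-zeroˡ (a ∷ p) q p≈0 k = begin
    coeff (a · q +ₚ (0ℤ ∷ (p *ₚ q))) k            ≡⟨ coeff-+ₚ (a · q) _ k ⟩
    coeff (a · q) k + coeff (0ℤ ∷ (p *ₚ q)) k     ≡⟨ cong₂ _+_ (coeff-· a q k) (shifted k) ⟩
    a * coeff q k + 0ℤ                          ≡⟨ cong (λ b → b * coeff q k + 0ℤ) (p≈0 zero) ⟩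
    0ℤ                                          ∎
    where
    open ≡-Reasoning
    shifted : ∀ k → coeff (0ℤ ∷ (p *ₚ q)) k ≡ 0ℤ
    shifted zero    = refl
    shifted (suc k) = *ₚ-zeroˡ p q (λ j → p≈0 (suc j)) k

  *ₚ-congʳ : ∀ {p p′} q → p ≋ p′ → (p *ₚ q) ≋ (p′ *ₚ q)
  *ₚ-congʳ {[]}    {p′}     q (mk≋ e) = mk≋ λ k → sym (*ₚ-zeroˡ p′ q (λ j → sym (e j)) k)
  *ₚ-congʳ {a ∷ p} {[]}     q (mk≋ e) = mk≋ (*ₚ-zeroˡ (a ∷ p) q e)
  *ₚ-congʳ {a ∷ p} {b ∷ p′} q (mk≋ e) with e zero
  ... | refl = +ₚ-cong (≋-refl {a · q}) (∷-cong 0ℤ (*ₚ-congʳ {p} {p′} q (mk≋ λ k → e (suc k))))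

  *ₚ-zeroʳ : ∀ p → (p *ₚ []) ≋ []
  *ₚ-zeroʳ p = mk≋ (go p)
    where
    go : ∀ p → (p *ₚ []) ≈ₚ []
    go []      k       = refl
    go (a ∷ p) zero    = refl
    go (a ∷ p) (suc k) = go p k

  *ₚ-∷ʳ : ∀ p b q → (p *ₚ (b ∷ q)) ≋ (b · p +ₚ (0ℤ ∷ (p *ₚ q)))
  *ₚ-∷ʳ []      b q = mk≋ λ where
    zero    → refl
    (suc k) → refl
  *ₚ-∷ʳ (a ∷ p) b q = mk≋ λ where
      zero    → trans (ℤ.+-identityʳ _) (trans (ℤ.*-comm a b) (sym (ℤ.+-identityʳ _)))
      (suc k) → begin
        coeff (a · q +ₚ (p *ₚ (b ∷ q))) k                              ≡⟨ coeff-+ₚ (a · q) _ k ⟩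
        coeff (a · q) k + coeff (p *ₚ (b ∷ q)) k                     ≡⟨ cong (coeff (a · q) k +_) (coeff-≡ (*ₚ-∷ʳ p b q) k) ⟩
        coeff (a · q) k + coeff (b · p +ₚ (0ℤ ∷ (p *ₚ q))) k           ≡⟨ cong (coeff (a · q) k +_) (coeff-+ₚ (b · p) _ k) ⟩
        coeff (a · q) k + (coeff (b · p) k + coeff (0ℤ ∷ (p *ₚ q)) k)  ≡⟨ exchange (coeff (a · q) k) (coeff (b · p) k) _ ⟩
        coeff (b · p) k + (coeff (a · q) k + coeff (0ℤ ∷ (p *ₚ q)) k)  ≡⟨ cong (coeff (b · p) k +_) (coeff-+ₚ (a · q) _ k) ⟨
        coeff (b · p) k + coeff (a · q +ₚ (0ℤ ∷ (p *ₚ q))) k           ≡⟨ coeff-+ₚ (b · p) _ k ⟨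
        coeff (b · p +ₚ (a · q +ₚ (0ℤ ∷ (p *ₚ q)))) k                  ∎
    where
    open ≡-Reasoning
    exchange : ∀ x y z → x + (y + z) ≡ y + (x + z)
    exchange = solve 3 (λ x y z → x :+ (y :+ z) := y :+ (x :+ z)) refl

  *ₚ-comm : ∀ p q → (p *ₚ q) ≋ (q *ₚ p)
  *ₚ-comm []      q = ≋-sym (*ₚ-zeroʳ q)
  *ₚ-comm (a ∷ p) q =
    ≋-trans (+ₚ-cong (≋-refl {a · q}) (∷-cong 0ℤ (*ₚ-comm p q))) (≋-sym (*ₚ-∷ʳ q a p))

  *ₚ-distribʳ : ∀ p q r → ((p +ₚ q) *ₚ r) ≋ ((p *ₚ r) +ₚ (q *ₚ r))
  *ₚ-distribʳ []      q       r = ≋-refl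
  *ₚ-distribʳ (a ∷ p) []      r = ≋-sym (+ₚ-identityʳ ((a ∷ p) *ₚ r))
  *ₚ-distribʳ (a ∷ p) (b ∷ q) r = mk≋ λ k → begin
    coeff ((a + b) · r +ₚ (0ℤ ∷ ((p +ₚ q) *ₚ r))) k
      ≡⟨ coeff-+ₚ ((a + b) · r) _ k ⟩
    coeff ((a + b) · r) k + coeff (0ℤ ∷ ((p +ₚ q) *ₚ r)) k
      ≡⟨ cong₂ _+_ (coeff-· (a + b) r k) (coeff-≡ (∷-cong 0ℤ (*ₚ-distribʳ p q r)) k) ⟩
    (a + b) * coeff r k + coeff (0ℤ ∷ ((p *ₚ r) +ₚ (q *ₚ r))) k
      ≡⟨ cong ((a + b) * coeff r k +_) (shifted k) ⟩
    (a + b) * coeff r k + (coeff (0ℤ ∷ (p *ₚ r)) k + coeff (0ℤ ∷ (q *ₚ r)) k)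
      ≡⟨ regroup a b (coeff r k) _ _ ⟩
    (a * coeff r k + coeff (0ℤ ∷ (p *ₚ r)) k) + (b * coeff r k + coeff (0ℤ ∷ (q *ₚ r)) k)
      ≡⟨ cong₂ _+_ (unfold a p k) (unfold b q k) ⟨
    coeff ((a ∷ p) *ₚ r) k + coeff ((b ∷ q) *ₚ r) k
      ≡⟨ coeff-+ₚ ((a ∷ p) *ₚ r) _ k ⟨
    coeff (((a ∷ p) *ₚ r) +ₚ ((b ∷ q) *ₚ r)) k
      ∎
    where
    open ≡-Reasoning
    shifted : ∀ k → coeff (0ℤ ∷ ((p *ₚ r) +ₚ (q *ₚ r))) k ≡ coeff (0ℤ ∷ (p *ₚ r)) k + coeff (0ℤ ∷ (q *ₚ r)) k
    shifted zero    = refl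
    shifted (suc k) = coeff-+ₚ (p *ₚ r) _ k
    unfold : ∀ c s k → coeff ((c ∷ s) *ₚ r) k ≡ c * coeff r k + coeff (0ℤ ∷ (s *ₚ r)) k
    unfold c s k = trans (coeff-+ₚ (c · r) _ k) (cong (_+ coeff (0ℤ ∷ (s *ₚ r)) k) (coeff-· c r k))
    regroup : ∀ a b c x y → (a + b) * c + (x + y) ≡ (a * c + x) + (b * c + y)
    regroup = solve 5 (λ a b c x y → (a :+ b) :* c :+ (x :+ y) := (a :* c :+ x) :+ (b :* c :+ y)) refl

  ·-*ₚ-assoc : ∀ a q r → ((a · q) *ₚ r) ≋ (a · (q *ₚ r))
  ·-*ₚ-assoc a []      r = ≋-refl
  ·-*ₚ-assoc a (b ∷ q) r = mk≋ λ k → begin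
    coeff ((a * b) · r +ₚ (0ℤ ∷ ((a · q) *ₚ r))) k
      ≡⟨ coeff-+ₚ ((a * b) · r) _ k ⟩
    coeff ((a * b) · r) k + coeff (0ℤ ∷ ((a · q) *ₚ r)) k
      ≡⟨ cong₂ _+_ (coeff-· (a * b) r k) (coeff-≡ (∷-cong 0ℤ (·-*ₚ-assoc a q r)) k) ⟩
    (a * b) * coeff r k + coeff (0ℤ ∷ a · (q *ₚ r)) k
      ≡⟨ cong ((a * b) * coeff r k +_) (shifted k) ⟩
    (a * b) * coeff r k + a * coeff (0ℤ ∷ (q *ₚ r)) k
      ≡⟨ factor a b (coeff r k) _ ⟩
    a * (b * coeff r k + coeff (0ℤ ∷ (q *ₚ r)) k)
      ≡⟨ cong (a *_) (trans (coeff-+ₚ (b · r) _ k) (cong (_+ _) (coeff-· b r k))) ⟨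
    a * coeff ((b ∷ q) *ₚ r) k
      ≡⟨ coeff-· a ((b ∷ q) *ₚ r) k ⟨
    coeff (a · ((b ∷ q) *ₚ r)) k
      ∎
    where
    open ≡-Reasoning
    shifted : ∀ k → coeff (0ℤ ∷ a · (q *ₚ r)) k ≡ a * coeff (0ℤ ∷ (q *ₚ r)) k
    shifted zero    = sym (ℤ.*-zeroʳ a)
    shifted (suc k) = coeff-· a (q *ₚ r) k
    factor : ∀ a b c x → (a * b) * c + a * x ≡ a * (b * c + x)
    factor = solve 4 (λ a b c x → (a :* b) :* c :+ a :* x := a :* (b :* c :+ x)) refl

  *ₚ-assoc : ∀ p q r → ((p *ₚ q) *ₚ r) ≋ (p *ₚ (q *ₚ r))
  *ₚ-assoc []      q r = ≋-refl
  *ₚ-assoc (a ∷ p) q r =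
    ≋-trans (*ₚ-distribʳ (a · q) (0ℤ ∷ (p *ₚ q)) r)
            (+ₚ-cong (·-*ₚ-assoc a q r) (≋-trans shift-*ₚ (∷-cong 0ℤ (*ₚ-assoc p q r))))
    where
    shift-*ₚ : ((0ℤ ∷ (p *ₚ q)) *ₚ r) ≋ (0ℤ ∷ (p *ₚ q) *ₚ r)
    shift-*ₚ = +ₚ-cong {0ℤ · r} {[]} (mk≋ (coeff-· 0ℤ r)) ≋-refl

  *ₚ-identityˡ : ∀ p → (oneₚ *ₚ p) ≋ p
  *ₚ-identityˡ p = mk≋ λ k → trans (coeff-+ₚ (1ℤ · p) (0ℤ ∷ []) k)
    (trans (cong₂ _+_ (coeff-· 1ℤ p k) (vanish k)) (trans (ℤ.+-identityʳ _) (ℤ.*-identityˡ _)))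
    where
    vanish : ∀ k → coeff (0ℤ ∷ []) k ≡ 0ℤ
    vanish zero    = refl
    vanish (suc k) = refl

  commutativeRing : CommutativeRing _ _
  commutativeRing = record
    { Carrier = Poly
    ; _≈_ = _≋_
    ; _+_ = _+ₚ_
    ; _*_ = _*ₚ_
    ; -_ = negₚ
    ; 0# = []
    ; 1# = oneₚ
    ; isCommutativeRing = record
      { isRing = record
        { +-isAbelianGroup = record
          { isGroup = record
            { isMonoid = record
              { isSemigroup = record
                { isMagma = record
                  { isEquivalence = record { refl = ≋-refl ; sym = ≋-sym ; trans = ≋-trans }
                  ; ∙-cong = +ₚ-cong }
                ; assoc = +ₚ-assoc }
              ; identity = (λ _ → ≋-refl) , +ₚ-identityʳ }
            ; inverse = (λ p → ≋-trans (+ₚ-comm (negₚ p) p) (+ₚ-inverseʳ p)) , +ₚ-inverseʳ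
            ; ⁻¹-cong = negₚ-cong }
          ; comm = +ₚ-comm }
        ; *-cong = λ {p} {p′} {q} {q′} p≋p′ q≋q′ →
            ≋-trans (*ₚ-congʳ q p≋p′) (≋-trans (*ₚ-comm p′ q) (≋-trans (*ₚ-congʳ p′ q≋q′) (*ₚ-comm q′ p′)))
        ; *-assoc = *ₚ-assoc
        ; *-identity = *ₚ-identityˡ , λ p → ≋-trans (*ₚ-comm p oneₚ) (*ₚ-identityˡ p)
        ; distrib = (λ p q r → ≋-trans (*ₚ-comm p (q +ₚ r))
                                 (≋-trans (*ₚ-distribʳ q r p) (+ₚ-cong (*ₚ-comm q p) (*ₚ-comm r p))))
                  , (λ p q r → *ₚ-distribʳ q r p) }
      ; *-comm = *ₚ-comm }
    }

module PolynomialFacts where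
  open PolynomialRing
  open import Data.Nat using (zero; suc; _+_)
  open import Data.Integer as ℤ using (ℤ; 0ℤ; -_)
  import Data.Integer.Properties as ℤ
  open import Data.List using (List; []; _∷_; length; drop)
  open import Relation.Binary.PropositionalEquality
  open import Algebra.Properties.Semiring.Exp (CommutativeRing.semiring commutativeRing) using (_^_)
  open ListSums commutativeRing using (∑)
  module ℤ∑ = ListSums ℤ.+-*-commutativeRing
  open import Data.Integer.Solver using (module +-*-Solver)
  open +-*-Solver using (solve; _:+_; _:-_; :-_; _:=_)

  constₚ : ℤ → Poly
  constₚ a = a ∷ []

  ^ₚ≡^ : ∀ p k → p ^ₚ k ≡ p ^ k
  ^ₚ≡^ p zero    = refl
  ^ₚ≡^ p (suc k) = cong (p *ₚ_) (^ₚ≡^ p k)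

  constₚ-∑ : ∀ {A : Set} (xs : List A) f → constₚ (ℤ∑.∑ xs f) ≋ ∑[ x ∈ xs ] constₚ (f x)
  constₚ-∑ []       f = mk≋ λ where
    zero    → refl
    (suc k) → refl
  constₚ-∑ (x ∷ xs) f = +ₚ-cong (≋-refl {constₚ (f x)}) (constₚ-∑ xs f)

  Xₚ-*ₚ : ∀ q → (Xₚ *ₚ q) ≋ (0ℤ ∷ q)
  Xₚ-*ₚ q = +ₚ-cong {0ℤ · q} {[]} (mk≋ (coeff-· 0ℤ q)) (∷-cong 0ℤ (*ₚ-identityˡ q))

  monoₚ-≋ : ∀ c k → monoₚ c k ≋ (constₚ c *ₚ (Xₚ ^ k))
  monoₚ-≋ c zero    = ≋-sym (≋-trans (*ₚ-comm (constₚ c) oneₚ) (*ₚ-identityˡ (constₚ c)))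
  monoₚ-≋ c (suc k) = ≋-sym (begin
    constₚ c *ₚ (Xₚ *ₚ (Xₚ ^ k))  ≈⟨ x∙yz≈y∙xz (constₚ c) Xₚ (Xₚ ^ k) ⟩
    Xₚ *ₚ (constₚ c *ₚ (Xₚ ^ k))  ≈⟨ Xₚ-*ₚ _ ⟩
    0ℤ ∷ (constₚ c *ₚ (Xₚ ^ k))   ≈⟨ ∷-cong 0ℤ (monoₚ-≋ c k) ⟨
    0ℤ ∷ monoₚ c k                ∎)
    where
    open import Relation.Binary.Reasoning.Setoid (CommutativeRing.setoid commutativeRing)
    open import Algebra.Properties.CommutativeSemigroup
      (CommutativeRing.*-commutativeSemigroup commutativeRing) using (x∙yz≈y∙xz)

  x-1 : Poly
  x-1 = Xₚ +ₚ (negₚ oneₚ)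

  coeff-x-1-*ₚ-zero : ∀ q → coeff (x-1 *ₚ q) zero ≡ - coeff q zero
  coeff-x-1-*ₚ-zero q =
    trans (coeff-+ₚ (ℤ.-1ℤ · q) _ zero)
          (trans (ℤ.+-identityʳ _) (trans (coeff-· ℤ.-1ℤ q zero) (ℤ.-1*i≡-i (coeff q zero))))

  coeff-x-1-*ₚ-suc : ∀ q k → coeff (x-1 *ₚ q) (suc k) ≡ coeff q k ℤ.- coeff q (suc k)
  coeff-x-1-*ₚ-suc q k = begin
    coeff (x-1 *ₚ q) (suc k)                           ≡⟨ coeff-+ₚ (ℤ.-1ℤ · q) _ (suc k) ⟩
    coeff (ℤ.-1ℤ · q) (suc k) ℤ.+ coeff (oneₚ *ₚ q) k  ≡⟨ cong₂ ℤ._+_ minus (coeff-≡ (*ₚ-identityˡ q) k) ⟩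
    - coeff q (suc k) ℤ.+ coeff q k                    ≡⟨ ℤ.+-comm (- coeff q (suc k)) (coeff q k) ⟩
    coeff q k ℤ.- coeff q (suc k)                      ∎
    where
    open ≡-Reasoning
    minus : coeff (ℤ.-1ℤ · q) (suc k) ≡ - coeff q (suc k)
    minus = trans (coeff-· ℤ.-1ℤ q (suc k)) (ℤ.-1*i≡-i _)

  coeff-beyond : ∀ q k → coeff q (length q + k) ≡ 0ℤ
  coeff-beyond []      k = refl
  coeff-beyond (a ∷ q) k = coeff-beyond q k

  coeff-drop-1 : ∀ q k → coeff (drop 1 q) k ≡ coeff q (suc k)
  coeff-drop-1 []      k = refl
  coeff-drop-1 (a ∷ q) k = refl

  constant-coeffs⇒≈[] : ∀ q → (∀ k → coeff q k ≡ coeff q (suc k)) → q ≈ₚ []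
  constant-coeffs⇒≈[] q step k = trans (shift (length q) k) (coeff-beyond q k)
    where
    shift : ∀ j k → coeff q k ≡ coeff q (j + k)
    shift zero    k = refl
    shift (suc j) k = trans (shift j k) (step (j + k))

  -- Synthetic division inverts multiplication by x - 1, whose coefficients are - q₀, then qₖ - qₖ₊₁.
  div-acc-correct : ∀ s p q → s ≡ - coeff q zero →
                    (∀ k → coeff p k ≡ coeff q k ℤ.- coeff q (suc k)) → div-acc s p ≈ₚ q
  div-acc-correct s []      q s≡ p≡ k =
    sym (constant-coeffs⇒≈[] q (λ j → ℤ.i-j≡0⇒i≡j _ _ (sym (p≡ j))) k)
  div-acc-correct s (b ∷ p) q s≡ p≡ zero    = trans (cong -_ s≡) (ℤ.neg-involutive _)
  div-acc-correct s (b ∷ p) q s≡ p≡ (suc k) =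
    trans (div-acc-correct (s ℤ.+ b) p (drop 1 q) s+b≡ p≡′ k) (coeff-drop-1 q k)
    where
    s+b≡ : s ℤ.+ b ≡ - coeff (drop 1 q) zero
    s+b≡ = trans (cong₂ ℤ._+_ s≡ (p≡ zero))
      (trans (solve 2 (λ x y → :- x :+ (x :- y) := :- y) refl (coeff q 0) (coeff q 1))
             (cong -_ (sym (coeff-drop-1 q zero))))
    p≡′ : ∀ k → coeff p k ≡ coeff (drop 1 q) k ℤ.- coeff (drop 1 q) (suc k)
    p≡′ k = trans (p≡ (suc k)) (sym (cong₂ ℤ._-_ (coeff-drop-1 q k) (coeff-drop-1 q (suc k))))

  div-x-1-correct : ∀ p q → p ≋ (x-1 *ₚ q) → div-x-1 p ≋ q
  div-x-1-correct []      q (mk≋ p≡) =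
    mk≋ (div-acc-correct 0ℤ [] q (trans (p≡ zero) (coeff-x-1-*ₚ-zero q))
                                 (λ k → trans (p≡ (suc k)) (coeff-x-1-*ₚ-suc q k)))
  div-x-1-correct (a ∷ p) q (mk≋ p≡) =
    mk≋ (div-acc-correct a p q (trans (p≡ zero) (coeff-x-1-*ₚ-zero q))
                               (λ k → trans (p≡ (suc k)) (coeff-x-1-*ₚ-suc q k)))

module SubsetFacts where
  open import Data.Bool using (true; false; T; not)
  open import Data.Bool.Properties using (T-∧)
  open import Data.Empty using (⊥-elim)
  import Data.Fin as Fin
  open import Data.Nat using (zero; suc)
  open import Data.Fin.Subset using (_⊆_; _∪_; _∩_; ⁅_⁆; inside; outside) renaming (_∈_ to _∈ₛ_; _∉_ to _∉ₛ_)
  import Data.Fin.Subset.Properties as Subset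
  open import Data.List using (map)
  open import Data.List.Membership.Propositional using (_∈_)
  open import Data.List.Membership.Propositional.Properties using (∈-++⁺ˡ; ∈-++⁺ʳ; ∈-map⁺; ∈-map⁻)
  open import Data.List.Relation.Unary.Any using (here)
  open import Data.List.Relation.Unary.Unique.Propositional using (Unique)
  import Data.List.Relation.Unary.Unique.Propositional.Properties as Unique
  import Data.List.Relation.Unary.AllPairs as AllPairs
  import Data.List.Relation.Unary.All as All
  open import Data.Product using (∃-syntax; _×_; _,_)
  open import Data.Sum using (inj₁; inj₂)
  open import Data.Vec using ([]; _∷_; lookup)
  import Data.Vec as Vec
  open import Data.Vec.Properties using ([]=⇒lookup)
  open import Function using (Equivalence; _∘′_)
  open import Relation.Binary.PropositionalEquality using (_≡_; _≢_; refl; sym; trans; cong)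
  open import Relation.Nullary using (¬_)
  open import Relation.Nullary.Decidable using (toWitness; fromWitness)

  private variable
    n : ℕ
    X Y : Subset n

  T-not⇒¬T : ∀ {b} → T (not b) → ¬ T b
  T-not⇒¬T {true}  () _
  T-not⇒¬T {false} _  ()

  ¬T⇒T-not : ∀ {b} → ¬ T b → T (not b)
  ¬T⇒T-not {true}  ¬t = ¬t _
  ¬T⇒T-not {false} ¬t = _

  ⊆ᵇ-sound : T (X ⊆ᵇ Y) → X ⊆ Y
  ⊆ᵇ-sound = toWitness

  ⊆ᵇ-complete : X ⊆ Y → T (X ⊆ᵇ Y)
  ⊆ᵇ-complete X⊆Y = fromWitness λ {x} → X⊆Y {x}

  =ˢ-sound : T (X =ˢ Y) → X ≡ Y
  =ˢ-sound = toWitness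

  =ˢ-complete : X ≡ Y → T (X =ˢ Y)
  =ˢ-complete = fromWitness

  ⊂ᵇ-sound : T (X ⊂ᵇ Y) → X ⊆ Y × X ≢ Y
  ⊂ᵇ-sound t with Equivalence.to T-∧ t
  ... | X⊆Y , X≠Y = ⊆ᵇ-sound X⊆Y , λ X≡Y → T-not⇒¬T X≠Y (=ˢ-complete X≡Y)

  ⊂ᵇ-complete : X ⊆ Y → X ≢ Y → T (X ⊂ᵇ Y)
  ⊂ᵇ-complete X⊆Y X≢Y = Equivalence.from T-∧ (⊆ᵇ-complete X⊆Y , ¬T⇒T-not λ t → X≢Y (=ˢ-sound t))

  allSubsets-complete : ∀ {n} (X : Subset n) → X ∈ allSubsets n
  allSubsets-complete []                = here refl
  allSubsets-complete {suc n} (false ∷ X) = ∈-++⁺ˡ (∈-map⁺ (outside ∷_) (allSubsets-complete X))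
  allSubsets-complete {suc n} (true ∷ X)  =
    ∈-++⁺ʳ (map (outside ∷_) (allSubsets n)) (∈-map⁺ (inside ∷_) (allSubsets-complete X))

  allSubsets-unique : ∀ n → Unique (allSubsets n)
  allSubsets-unique zero    = All.[] AllPairs.∷ AllPairs.[]
  allSubsets-unique (suc n) =
    Unique.++⁺ (Unique.map⁺ ∷-injectiveʳ (allSubsets-unique n))
               (Unique.map⁺ ∷-injectiveʳ (allSubsets-unique n)) disjoint
    where
    ∷-injectiveʳ : ∀ {b} {X Y : Subset n} → _≡_ {A = Subset (suc n)} (b ∷ X) (b ∷ Y) → X ≡ Y
    ∷-injectiveʳ refl = refl
    disjoint : ∀ {X} → ¬ (X ∈ map (outside ∷_) (allSubsets n) × X ∈ map (inside ∷_) (allSubsets n))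
    disjoint (p , q) with ∈-map⁻ (outside ∷_) p | ∈-map⁻ (inside ∷_) q
    ... | _ , _ , refl | _ , _ , ()

  lookup≡false⇒∉ : ∀ {n} {X : Subset n} {e} → lookup X e ≡ false → e ∉ₛ X
  lookup≡false⇒∉ X[e]≡false e∈X with () ← trans (sym ([]=⇒lookup e∈X)) X[e]≡false

  ∪-least : ∀ {n} {A B C : Subset n} → A ⊆ C → B ⊆ C → A ∪ B ⊆ C
  ∪-least {A = A} {B} A⊆C B⊆C x∈ with Subset.x∈p∪q⁻ A B x∈
  ... | inj₁ x∈A = A⊆C x∈A
  ... | inj₂ x∈B = B⊆C x∈B

  ⁅⁆⊆ : ∀ {n} {e} {C : Subset n} → e ∈ₛ C → ⁅ e ⁆ ⊆ C
  ⁅⁆⊆ {e = e} e∈C x∈ rewrite Subset.x∈⁅y⁆⇒x≡y e x∈ = e∈C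

  ⊆∪ˡ : ∀ {n} {A} (B : Subset n) → A ⊆ A ∪ B
  ⊆∪ˡ B = Subset.p⊆p∪q B

  ⊆∪ʳ : ∀ {n} (A : Subset n) {B} → B ⊆ A ∪ B
  ⊆∪ʳ A = Subset.q⊆p∪q A _

  ⊆∧≢⇒∃∉ : ∀ {n} {X Y : Subset n} → X ⊆ Y → X ≢ Y → ∃[ e ] (e ∈ₛ Y × e ∉ₛ X)
  ⊆∧≢⇒∃∉ {X = []}          {[]}          _   X≢Y = ⊥-elim (X≢Y refl)
  ⊆∧≢⇒∃∉ {X = false ∷ X}   {true ∷ Y}    _   _   = Fin.zero , Vec.here , λ ()
  ⊆∧≢⇒∃∉ {X = true ∷ X}    {false ∷ Y}   X⊆Y _   with () ← X⊆Y Vec.here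
  ⊆∧≢⇒∃∉ {X = false ∷ X}   {false ∷ Y}   X⊆Y X≢Y with ⊆∧≢⇒∃∉ (Subset.drop-∷-⊆ X⊆Y) (X≢Y ∘′ cong (false ∷_))
  ... | e , e∈Y , e∉X = Fin.suc e , Vec.there e∈Y , e∉X ∘′ Subset.drop-there
  ⊆∧≢⇒∃∉ {X = true ∷ X}    {true ∷ Y}    X⊆Y X≢Y with ⊆∧≢⇒∃∉ (Subset.drop-∷-⊆ X⊆Y) (X≢Y ∘′ cong (true ∷_))
  ... | e , e∈Y , e∉X = Fin.suc e , Vec.there e∈Y , e∉X ∘′ Subset.drop-there

  ∩-greatest : ∀ {n} {A B C : Subset n} → C ⊆ A → C ⊆ B → C ⊆ A ∩ B
  ∩-greatest C⊆A C⊆B x∈ = Subset.x∈p∩q⁺ (C⊆A x∈ , C⊆B x∈)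

module MatroidFacts {m : ℕ} (M : Matroid m) where
  open Matroid M
  open LatticeOfFlats M
  open SubsetFacts

  open import Data.Bool using (Bool; true; false; T; not; _∧_; _∨_)
  open import Data.Bool.Properties using (T-∧; T-∨)
  open import Data.Empty using (⊥-elim)
  open import Data.Fin using (Fin)
  open import Data.Fin.Subset using (_⊆_; _∪_; _∩_; ⁅_⁆; ⊥) renaming (_∈_ to _∈ₛ_; _∉_ to _∉ₛ_)
  import Data.Fin.Subset.Properties as Subset
  open import Data.List using (List; []; _∷_; filter; allFin)
  open import Data.List.Membership.Propositional using (_∈_)
  open import Data.List.Membership.Propositional.Properties using (∈-filter⁺; ∈-filter⁻; ∈-allFin)
  open import Data.List.Relation.Unary.Any using (here; there)
  open import Data.List.Relation.Unary.Unique.Propositional using (Unique)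
  import Data.List.Relation.Unary.Unique.Propositional.Properties as Unique
  open import Data.Nat using (suc; _≤_; _<_; _+_; z≤n; s≤s; _<ᵇ_; _≤ᵇ_)
  import Data.Nat.Properties as ℕ
  open import Data.Product using (_×_; _,_; proj₁; proj₂)
  open import Data.Sum using (_⊎_; inj₁; inj₂)
  open import Data.Vec using (lookup)
  open import Data.Vec.Properties using (lookup⇒[]=; ≡-dec)
  import Data.Bool.Properties
  open import Function using (Equivalence; _∘′_)
  open import Relation.Binary.PropositionalEquality
  open import Relation.Nullary using (¬_; yes; no)
  import Data.Bool

  Flat : Subset m → Set
  Flat X = T (isFlat X)

  flats-sound : ∀ {X} → X ∈ flats → Flat X
  flats-sound X∈ = proj₂ (∈-filter⁻ (λ Y → Data.Bool.T? (isFlat Y)) {xs = allSubsets m} X∈)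

  flats-complete : ∀ {X} → Flat X → X ∈ flats
  flats-complete {X} flat = ∈-filter⁺ (λ Y → Data.Bool.T? (isFlat Y)) (allSubsets-complete X) flat

  flats-unique : Unique flats
  flats-unique = Unique.filter⁺ (λ Y → Data.Bool.T? (isFlat Y)) (allSubsets-unique m)

  flat-rank-jump : ∀ {X} → Flat X → ∀ e → e ∉ₛ X → r X < r (X ∪ ⁅ e ⁆)
  flat-rank-jump {X} flat e e∉X = go (lookup X e) refl (allL-sound (allFin m) flat (∈-allFin e))
    where
    allL-sound : ∀ {p : Fin m → Bool} xs → T (allL p xs) → ∀ {x} → x ∈ xs → T (p x)
    allL-sound (y ∷ xs) t (here refl) = proj₁ (Equivalence.to T-∧ t)
    allL-sound (y ∷ xs) t (there x∈)  = allL-sound xs (proj₂ (Equivalence.to T-∧ t)) x∈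
    go : ∀ b → lookup X e ≡ b → T (b ∨ (r X <ᵇ r (X ∪ ⁅ e ⁆))) → r X < r (X ∪ ⁅ e ⁆)
    go true  X[e]≡true  _ = ⊥-elim (e∉X (lookup⇒[]= e X X[e]≡true))
    go false _          t = ℕ.<ᵇ⇒< _ _ t

  rank-jump⇒flat : ∀ {X} → (∀ e → e ∉ₛ X → r X < r (X ∪ ⁅ e ⁆)) → Flat X
  rank-jump⇒flat {X} jump = allL-complete (allFin m)
    where
    holds : ∀ e → T (lookup X e ∨ (r X <ᵇ r (X ∪ ⁅ e ⁆)))
    holds e with lookup X e in X[e]
    ... | true  = _
    ... | false = ℕ.<⇒<ᵇ (jump e (lookup≡false⇒∉ X[e]))
    allL-complete : ∀ xs → T (allL (λ e → lookup X e ∨ (r X <ᵇ r (X ∪ ⁅ e ⁆))) xs)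
    allL-complete []       = _
    allL-complete (e ∷ xs) = Equivalence.from T-∧ (holds e , allL-complete xs)

  r⊥≡0 : r ⊥ ≡ 0
  r⊥≡0 = ℕ.n≤0⇒n≡0 (subst (r ⊥ ≤_) (Subset.∣⊥∣≡0 m) (r-bound ⊥))

  r≤m : ∀ X → r X ≤ m
  r≤m X = ℕ.≤-trans (r-bound X) (Subset.∣p∣≤n X)

  m≮r+0 : ∀ X → ¬ (m < r X + 0)
  m≮r+0 X m< = ℕ.<⇒≱ m< (subst (_≤ m) (sym (ℕ.+-identityʳ (r X))) (r≤m X))

  ⊥-flat : Loopless M → Flat ⊥
  ⊥-flat loopless = rank-jump⇒flat λ e _ →
    subst₂ _<_ (sym r⊥≡0) (sym (trans (cong r (Subset.∪-identityˡ ⁅ e ⁆)) (loopless e))) (s≤s z≤n)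

  flat-rank-strict : ∀ {X Y} → Flat X → X ⊆ Y → X ≢ Y → r X < r Y
  flat-rank-strict flatX X⊆Y X≢Y with ⊆∧≢⇒∃∉ X⊆Y X≢Y
  ... | e , e∈Y , e∉X = ℕ.<-≤-trans (flat-rank-jump flatX e e∉X) (r-mono _ _ (∪-least X⊆Y (⁅⁆⊆ e∈Y)))

  r-∪⁅⁆≤ : ∀ X e → r (X ∪ ⁅ e ⁆) ≤ suc (r X)
  r-∪⁅⁆≤ X e = begin
    r (X ∪ ⁅ e ⁆)                      ≤⟨ ℕ.m≤m+n _ _ ⟩
    r (X ∪ ⁅ e ⁆) + r (X ∩ ⁅ e ⁆)      ≤⟨ r-submod X ⁅ e ⁆ ⟩
    r X + r ⁅ e ⁆                      ≤⟨ ℕ.+-monoʳ-≤ (r X) (subst (r ⁅ e ⁆ ≤_) (Subset.∣⁅x⁆∣≡1 e) (r-bound ⁅ e ⁆)) ⟩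
    r X + 1                            ≡⟨ ℕ.+-comm (r X) 1 ⟩
    suc (r X)                          ∎
    where open ℕ.≤-Reasoning

  r-∪-absorb : ∀ A B → r B ≤ r (A ∩ B) → r (A ∪ B) ≤ r A
  r-∪-absorb A B rB≤ = ℕ.+-cancelʳ-≤ (r (A ∩ B)) _ _
    (ℕ.≤-trans (r-submod A B) (ℕ.+-monoʳ-≤ (r A) rB≤))

  flat-closed : ∀ {Z A f} → Flat Z → A ⊆ Z → r (A ∪ ⁅ f ⁆) ≤ r A → f ∈ₛ Z
  flat-closed {Z} {A} {f} flatZ A⊆Z rA+f≤ with lookup Z f in Z[f]
  ... | true  = lookup⇒[]= f Z Z[f]
  ... | false = ⊥-elim (ℕ.<⇒≱ (flat-rank-jump flatZ f (lookup≡false⇒∉ Z[f])) rZ+f≤rZ)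
    where
    B : Subset m
    B = A ∪ ⁅ f ⁆
    rZ+f≤rZ : r (Z ∪ ⁅ f ⁆) ≤ r Z
    rZ+f≤rZ = ℕ.≤-trans (r-mono _ _ (∪-least (⊆∪ˡ B) (⊆∪ʳ Z ∘′ ⊆∪ʳ A)))
                (r-∪-absorb Z B (ℕ.≤-trans rA+f≤ (r-mono _ _ (∩-greatest A⊆Z (⊆∪ˡ ⁅ f ⁆)))))

  infixl 6 _∪ᴸ_
  _∪ᴸ_ : Subset m → List (Fin m) → Subset m
  X ∪ᴸ []       = X
  X ∪ᴸ (f ∷ fs) = (X ∪ᴸ fs) ∪ ⁅ f ⁆

  ⊆-∪ᴸ : ∀ X fs → X ⊆ X ∪ᴸ fs
  ⊆-∪ᴸ X []       = λ x∈ → x∈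
  ⊆-∪ᴸ X (f ∷ fs) = ⊆∪ˡ ⁅ f ⁆ ∘′ ⊆-∪ᴸ X fs

  ∈-∪ᴸ⁺ : ∀ X {fs f} → f ∈ fs → f ∈ₛ X ∪ᴸ fs
  ∈-∪ᴸ⁺ X {g ∷ fs} (here refl) = ⊆∪ʳ (X ∪ᴸ fs) (Subset.x∈⁅x⁆ g)
  ∈-∪ᴸ⁺ X {g ∷ fs} (there f∈)  = ⊆∪ˡ ⁅ g ⁆ (∈-∪ᴸ⁺ X f∈)

  ∈-∪ᴸ⁻ : ∀ X fs {e} → e ∈ₛ X ∪ᴸ fs → e ∈ₛ X ⊎ e ∈ fs
  ∈-∪ᴸ⁻ X []       e∈ = inj₁ e∈
  ∈-∪ᴸ⁻ X (f ∷ fs) e∈ with Subset.x∈p∪q⁻ (X ∪ᴸ fs) ⁅ f ⁆ e∈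
  ... | inj₂ e∈⁅f⁆ = inj₂ (here (Subset.x∈⁅y⁆⇒x≡y f e∈⁅f⁆))
  ... | inj₁ e∈′ with ∈-∪ᴸ⁻ X fs e∈′
  ...   | inj₁ e∈X  = inj₁ e∈X
  ...   | inj₂ e∈fs = inj₂ (there e∈fs)

  r-∪ᴸ≤ : ∀ X fs → (∀ {f} → f ∈ fs → r (X ∪ ⁅ f ⁆) ≤ r X) → r (X ∪ᴸ fs) ≤ r X
  r-∪ᴸ≤ X []       _       = ℕ.≤-refl
  r-∪ᴸ≤ X (f ∷ fs) neutral = ℕ.≤-trans
    (r-mono _ _ (∪-least (⊆∪ˡ B) (⊆∪ʳ A ∘′ ⊆∪ʳ X)))
    (ℕ.≤-trans (r-∪-absorb A B (ℕ.≤-trans (neutral (here refl)) (r-mono _ _ (∩-greatest (⊆-∪ᴸ X fs) (⊆∪ˡ ⁅ f ⁆)))))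
               (r-∪ᴸ≤ X fs (neutral ∘′ there)))
    where
    A B : Subset m
    A = X ∪ᴸ fs
    B = X ∪ ⁅ f ⁆

  rank-neutral : Subset m → Fin m → Bool
  rank-neutral A f = r (A ∪ ⁅ f ⁆) ≤ᵇ r A

  neutrals : Subset m → List (Fin m)
  neutrals A = filter (λ f → Data.Bool.T? (rank-neutral A f)) (allFin m)

  neutrals-sound : ∀ A {f} → f ∈ neutrals A → r (A ∪ ⁅ f ⁆) ≤ r A
  neutrals-sound A f∈ =
    ℕ.≤ᵇ⇒≤ _ _ (proj₂ (∈-filter⁻ (λ f → Data.Bool.T? (rank-neutral A f)) {xs = allFin m} f∈))

  closure : Subset m → Subset m
  closure A = A ∪ᴸ neutrals A

  r-closure : ∀ A → r (closure A) ≤ r A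
  r-closure A = r-∪ᴸ≤ A (neutrals A) (neutrals-sound A)

  closure-flat : ∀ A → Flat (closure A)
  closure-flat A = rank-jump⇒flat jump
    where
    jump : ∀ f → f ∉ₛ closure A → r (closure A) < r (closure A ∪ ⁅ f ⁆)
    jump f f∉ with rank-neutral A f in neutral
    ... | true  = ⊥-elim (f∉ (∈-∪ᴸ⁺ A (∈-filter⁺ (λ f → Data.Bool.T? (rank-neutral A f)) (∈-allFin f)
                                                   (subst T (sym neutral) _))))
    ... | false = ℕ.≤-<-trans (r-closure A) (ℕ.<-≤-trans (ℕ.≰⇒> λ le → subst T neutral (ℕ.≤⇒≤ᵇ le))
                    (r-mono _ _ (∪-least (⊆∪ˡ ⁅ f ⁆ ∘′ ⊆-∪ᴸ A (neutrals A)) (⊆∪ʳ (closure A)))))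

  closure-least : ∀ {A Z} → Flat Z → A ⊆ Z → closure A ⊆ Z
  closure-least {A} flatZ A⊆Z {f} f∈ with ∈-∪ᴸ⁻ A (neutrals A) f∈
  ... | inj₁ f∈A  = A⊆Z f∈A
  ... | inj₂ f∈fs = flat-closed flatZ A⊆Z (neutrals-sound A f∈fs)

  covers-sound : ∀ {X Z} → T (covers X Z) →
    Flat X × Flat Z × X ⊆ Z × X ≢ Z × (∀ {Y} → Flat Y → X ⊆ Y → X ≢ Y → Y ⊆ Z → Y ≡ Z)
  covers-sound {X} {Z} t with Equivalence.to T-∧ t
  ... | flatX , t′ with Equivalence.to T-∧ t′
  ... | flatZ , t″ with Equivalence.to T-∧ t″
  ... | X⊂Z , nothing-between =
    flatX , flatZ , proj₁ (⊂ᵇ-sound X⊂Z) , proj₂ (⊂ᵇ-sound X⊂Z) , between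
    where
    none : ∀ {Y} → Y ∈ flats → ¬ T ((X ⊂ᵇ Y) ∧ (Y ⊂ᵇ Z))
    none = anyL-false flats nothing-between
      where
      anyL-false : ∀ {p : Subset m → Bool} xs → T (not (anyL p xs)) → ∀ {Y} → Y ∈ xs → ¬ T (p Y)
      anyL-false {p} (Y ∷ xs) t (here refl) pY = T-not⇒¬T {p Y ∨ anyL p xs} t (Equivalence.from T-∨ (inj₁ pY))
      anyL-false {p} (W ∷ xs) t (there Y∈)  pY = anyL-false xs
        (¬T⇒T-not {anyL p xs} λ a → T-not⇒¬T {p W ∨ anyL p xs} t (Equivalence.from T-∨ (inj₂ a))) Y∈ pY
    between : ∀ {Y} → Flat Y → X ⊆ Y → X ≢ Y → Y ⊆ Z → Y ≡ Z
    between {Y} flatY X⊆Y X≢Y Y⊆Z with ≡-dec Data.Bool.Properties._≟_ Y Z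
    ... | yes Y≡Z = Y≡Z
    ... | no  Y≢Z = ⊥-elim (none (flats-complete flatY)
                      (Equivalence.from T-∧ (⊂ᵇ-complete X⊆Y X≢Y , ⊂ᵇ-complete Y⊆Z Y≢Z)))

  -- L(M) is graded: the closure of X together with one new element of Z is a flat
  -- strictly between X and Z, hence equal to Z, and its rank is at most r X + 1.
  covers⇒rank-suc : ∀ {X Z} → T (covers X Z) → r Z ≡ suc (r X)
  covers⇒rank-suc {X} {Z} X⋖Z with covers-sound X⋖Z
  ... | flatX , flatZ , X⊆Z , X≢Z , between with ⊆∧≢⇒∃∉ X⊆Z X≢Z
  ... | e , e∈Z , e∉X = ℕ.≤-antisym rZ≤ (flat-rank-strict flatX X⊆Z X≢Z)
    where
    A : Subset m
    A = X ∪ ⁅ e ⁆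
    A⊆closure : A ⊆ closure A
    A⊆closure = ⊆-∪ᴸ A (neutrals A)
    closure≡Z : closure A ≡ Z
    closure≡Z = between (closure-flat A) (A⊆closure ∘′ ⊆∪ˡ ⁅ e ⁆)
      (λ X≡cl → e∉X (subst (e ∈ₛ_) (sym X≡cl) (A⊆closure (⊆∪ʳ X (Subset.x∈⁅x⁆ e)))))
      (closure-least flatZ (∪-least X⊆Z (⁅⁆⊆ e∈Z)))
    rZ≤ : r Z ≤ suc (r X)
    rZ≤ = subst (λ W → r W ≤ suc (r X)) closure≡Z (ℕ.≤-trans (r-closure A) (r-∪⁅⁆≤ X e))

module SaturatedChains {m : ℕ} (M : Matroid m) where
  open Matroid M
  open LatticeOfFlats M
  open MatroidFacts M
  open SubsetFacts

  open import Data.Bool using (Bool; true; false; T; _∧_; if_then_else_)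
  open import Data.Bool.Properties using (T-∧)
  open import Data.Empty using (⊥-elim)
  open import Data.Fin.Subset using (_⊆_; ⊤)
  import Data.Fin.Subset.Properties as Subset
  open import Data.List using (List; []; _∷_; map; filter; concat; concatMap; length)
  open import Data.List.Properties using (map-cong-local)
  open import Data.List.Membership.Propositional using (_∈_; find)
  open import Data.List.Membership.Propositional.Properties using (∈-map⁻; ∈-filter⁻; ∈-filter⁺; ∈-concatMap⁻)
  open import Data.List.Relation.Unary.Any using (here)
  open import Data.List.Relation.Unary.Unique.Propositional using (Unique)
  import Data.List.Relation.Unary.Unique.Propositional.Properties as Unique
  import Data.List.Relation.Unary.AllPairs as AllPairs
  import Data.List.Relation.Unary.All as All
  open import Data.Nat using (zero; suc; _≤_; _<_; _+_; z≤n; s≤s)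
  import Data.Nat.Properties as ℕ
  open import Data.Product using (∃-syntax; _×_; _,_; proj₁; proj₂)
  open import Function using (Equivalence; _∘′_)
  open import Relation.Binary.PropositionalEquality
  open import Relation.Nullary using (¬_)
  import Data.Bool

  upperCovers : Subset m → List (Subset m)
  upperCovers a = filter (λ z → Data.Bool.T? (covers a z)) flats

  upperCovers-sound : ∀ {a z} → z ∈ upperCovers a → T (covers a z)
  upperCovers-sound {a} z∈ = proj₂ (∈-filter⁻ (λ z → Data.Bool.T? (covers a z)) {xs = flats} z∈)

  coversBelow : Subset m → Subset m → List (Subset m)
  coversBelow a b = filter (λ z → Data.Bool.T? (covers a z ∧ (z ⊆ᵇ b))) flats

  coversBelow-sound : ∀ {a b z} → z ∈ coversBelow a b → T (covers a z) × z ⊆ b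
  coversBelow-sound {a} {b} z∈ with Equivalence.to T-∧
    (proj₂ (∈-filter⁻ (λ z → Data.Bool.T? (covers a z ∧ (z ⊆ᵇ b))) {xs = flats} z∈))
  ... | a⋖z , z⊆b = a⋖z , ⊆ᵇ-sound z⊆b

  data SatChain : Subset m → Subset m → List (Subset m) → Set where
    [_]  : ∀ a → SatChain a a (a ∷ [])
    _∷_ : ∀ {a z b G} → T (covers a z) → SatChain z b G → SatChain a b (a ∷ G)

  SatChain⇒⊆ : ∀ {a b G} → SatChain a b G → a ⊆ b
  SatChain⇒⊆ [ a ]         = λ x∈ → x∈
  SatChain⇒⊆ (a⋖z ∷ chain) = SatChain⇒⊆ chain ∘′ proj₁ (proj₂ (proj₂ (covers-sound a⋖z)))

  SatChain-head : ∀ {a b G} → SatChain a b G → ∃[ G′ ] G ≡ a ∷ G′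
  SatChain-head [ a ]     = [] , refl
  SatChain-head (_ ∷ _)   = _ , refl

  labels-∷ : ∀ (lab : Subset m → Subset m → ℕ) {a z b G} →
             SatChain z b G → labels lab (a ∷ G) ≡ lab a z ∷ labels lab G
  labels-∷ lab [ z ]   = refl
  labels-∷ lab (_ ∷ _) = refl

  SatChain-length : ∀ (lab : Subset m → Subset m → ℕ) {a b G} →
                    SatChain a b G → length (labels lab G) + r a ≡ r b
  SatChain-length lab [ a ] = refl
  SatChain-length lab {a} (_∷_ {z = z} {G = G} a⋖z chain) = begin
    length (labels lab (a ∷ G)) + r a   ≡⟨ cong (λ w → length w + r a) (labels-∷ lab chain) ⟩
    suc (length (labels lab G)) + r a   ≡⟨ ℕ.+-suc (length (labels lab G)) (r a) ⟨
    length (labels lab G) + suc (r a)   ≡⟨ cong (length (labels lab G) +_) (covers⇒rank-suc a⋖z) ⟨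
    length (labels lab G) + r z         ≡⟨ SatChain-length lab chain ⟩
    _                                   ∎
    where open ≡-Reasoning

  -- Enough fuel: every step of a chain raises the rank, which is at most m.
  satChains′-fuel : ∀ f g a b → m < r a + f → m < r a + g → satChains′ f a b ≡ satChains′ g a b
  satChains′-fuel zero    _       a b m< _  = ⊥-elim (m≮r+0 a m<)
  satChains′-fuel (suc f) zero    a b _  m< = ⊥-elim (m≮r+0 a m<)
  satChains′-fuel (suc f) (suc g) a b m<f m<g with a =ˢ b
  ... | true  = refl
  ... | false = cong concat (map-cong-local (All.tabulate λ z∈ →
      cong (map (a ∷_)) (satChains′-fuel f g _ b (step z∈ m<f) (step z∈ m<g))))
    where
    step : ∀ {z k} → z ∈ coversBelow a b → m < r a + suc k → m < r z + k
    step {z} {k} z∈ m< rewrite covers⇒rank-suc (proj₁ (coversBelow-sound z∈)) = subst (m <_) (ℕ.+-suc (r a) k) m<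

  satChains-unfold : ∀ a b → satChains a b ≡
    (if a =ˢ b then (a ∷ []) ∷ [] else concatMap (λ z → map (a ∷_) (satChains z b)) (coversBelow a b))
  satChains-unfold a b with a =ˢ b
  ... | true  = refl
  ... | false = cong concat (map-cong-local (All.tabulate λ z∈ →
      cong (map (a ∷_)) (satChains′-fuel m (suc m) _ b (enough z∈ ℕ.≤-refl) (enough z∈ (ℕ.n≤1+n m)))))
    where
    enough : ∀ {z k} → z ∈ coversBelow a b → m ≤ k → m < r z + k
    enough {z} {k} z∈ m≤k rewrite covers⇒rank-suc (proj₁ (coversBelow-sound z∈)) =
      s≤s (ℕ.≤-trans m≤k (ℕ.m≤n+m k (r a)))

  satChains′-sound : ∀ f {a b G} → G ∈ satChains′ f a b → SatChain a b G
  satChains′-sound (suc f) {a} {b} G∈ with a =ˢ b in a=b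
  satChains′-sound (suc f) {a} {b} (here refl) | true with refl ← =ˢ-sound {X = a} {b} (subst T (sym a=b) _) = [ a ]
  satChains′-sound (suc f) {a} {b} G∈          | false
    with z , z∈ , G∈′ ← find (∈-concatMap⁻ (λ z → map (a ∷_) (satChains′ f z b)) {xs = coversBelow a b} G∈)
    with G′ , G′∈ , refl ← ∈-map⁻ (a ∷_) G∈′
    = proj₁ (coversBelow-sound z∈) ∷ satChains′-sound f G′∈

  satChains-sound : ∀ {a b G} → G ∈ satChains a b → SatChain a b G
  satChains-sound = satChains′-sound (suc m)

  satChains-refl : ∀ a → satChains a a ≡ (a ∷ []) ∷ []
  satChains-refl a with a =ˢ a in a=a
  ... | true  = refl
  ... | false = ⊥-elim (subst T a=a (=ˢ-complete {X = a} refl))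

  concatMap-unique : ∀ {A B : Set} (h : A → List B) xs → Unique xs → (∀ x → Unique (h x)) →
    (∀ {x y v} → v ∈ h x → v ∈ h y → x ≡ y) → Unique (concatMap h xs)
  concatMap-unique h []       _                     _       _        = AllPairs.[]
  concatMap-unique h (x ∷ xs) (x∉xs AllPairs.∷ xs!) h-unique h-disjoint =
    Unique.++⁺ (h-unique x) (concatMap-unique h xs xs! h-unique h-disjoint) disjoint
    where
    disjoint : ∀ {v} → ¬ (v ∈ h x × v ∈ concatMap h xs)
    disjoint (v∈hx , v∈rest) with y , y∈xs , v∈hy ← find (∈-concatMap⁻ h {xs = xs} v∈rest) =
      All.lookup x∉xs y∈xs (h-disjoint v∈hx v∈hy)

  satChains′-unique : ∀ f a b → Unique (satChains′ f a b)
  satChains′-unique zero    a b = AllPairs.[]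
  satChains′-unique (suc f) a b with a =ˢ b
  ... | true  = All.[] AllPairs.∷ AllPairs.[]
  ... | false = concatMap-unique _ (coversBelow a b)
      (Unique.filter⁺ (λ z → Data.Bool.T? (covers a z ∧ (z ⊆ᵇ b))) flats-unique)
      (λ z → Unique.map⁺ (λ where refl → refl) (satChains′-unique f z b))
      same-head
    where
    same-head : ∀ {x y v} → v ∈ map (a ∷_) (satChains′ f x b) → v ∈ map (a ∷_) (satChains′ f y b) → x ≡ y
    same-head v∈ v∈′ with G , G∈ , refl ← ∈-map⁻ (a ∷_) v∈ | G′ , G′∈ , refl ← ∈-map⁻ (a ∷_) v∈′
      with _ , refl ← SatChain-head (satChains′-sound f G∈) | _ , refl ← SatChain-head (satChains′-sound f G′∈)
      = refl

  satChains-unique : ∀ a b → Unique (satChains a b)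
  satChains-unique = satChains′-unique (suc m)

  strictlyAbove : Subset m → List (Subset m)
  strictlyAbove x = filter (λ y → Data.Bool.T? (x ⊂ᵇ y)) flats

  strictlyAbove-sound : ∀ x {y} → y ∈ strictlyAbove x → Flat y × x ⊆ y × x ≢ y
  strictlyAbove-sound x {y} y∈ with y∈flats , x⊂y ← ∈-filter⁻ (λ y → Data.Bool.T? (x ⊂ᵇ y)) {xs = flats} y∈ =
    flats-sound y∈flats , ⊂ᵇ-sound {X = x} {Y = y} x⊂y

  chainsFrom : Subset m → List (List (Subset m))
  chainsFrom = chainsFrom′ (suc m)

  chainsFrom′-fuel : ∀ f g x → Flat x → m < r x + f → m < r x + g → chainsFrom′ f x ≡ chainsFrom′ g x
  chainsFrom′-fuel zero    _       x _ m< _  = ⊥-elim (m≮r+0 x m<)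
  chainsFrom′-fuel (suc f) zero    x _ _  m< = ⊥-elim (m≮r+0 x m<)
  chainsFrom′-fuel (suc f) (suc g) x flat m<f m<g with x =ˢ ⊤
  ... | true  = refl
  ... | false = cong concat (map-cong-local (All.tabulate λ y∈ →
      cong (map (x ∷_)) (chainsFrom′-fuel f g _ (proj₁ (strictlyAbove-sound x y∈)) (step y∈ m<f) (step y∈ m<g))))
    where
    step : ∀ {y k} → y ∈ strictlyAbove x → m < r x + suc k → m < r y + k
    step {y} {k} y∈ m< with _ , x⊆y , x≢y ← strictlyAbove-sound x y∈ =
      ℕ.<-≤-trans (subst (m <_) (ℕ.+-suc (r x) k) m<) (ℕ.+-monoˡ-≤ k (flat-rank-strict flat x⊆y x≢y))

  chainsFrom-⊤ : ∀ {x} → x ≡ ⊤ → chainsFrom x ≡ (x ∷ []) ∷ []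
  chainsFrom-⊤ {x} x≡⊤ with x =ˢ ⊤ in x=⊤
  ... | true  = refl
  ... | false = ⊥-elim (subst T x=⊤ (=ˢ-complete x≡⊤))

  chainsFrom-≢⊤ : ∀ {x} → Flat x → x ≢ ⊤ → chainsFrom x ≡ concatMap (λ y → map (x ∷_) (chainsFrom y)) (strictlyAbove x)
  chainsFrom-≢⊤ {x} flat x≢⊤ with x =ˢ ⊤ in x=⊤
  ... | true  = ⊥-elim (x≢⊤ (=ˢ-sound (subst T (sym x=⊤) _)))
  ... | false = cong concat (map-cong-local (All.tabulate λ y∈ →
      cong (map (x ∷_)) (chainsFrom′-fuel m (suc m) _ (proj₁ (strictlyAbove-sound x y∈)) (enough y∈ ℕ.≤-refl) (enough y∈ (ℕ.n≤1+n m)))))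
    where
    enough : ∀ {y k} → y ∈ strictlyAbove x → m ≤ k → m < r y + k
    enough {y} {k} y∈ m≤k with _ , x⊆y , x≢y ← strictlyAbove-sound x y∈ =
      ℕ.<-≤-trans (s≤s m≤k) (ℕ.+-monoˡ-≤ k (ℕ.≤-trans (s≤s z≤n) (flat-rank-strict flat x⊆y x≢y)))

  chainsFrom′-head : ∀ f {x C} → C ∈ chainsFrom′ f x → ∃[ C′ ] C ≡ x ∷ C′
  chainsFrom′-head (suc f) {x} C∈ with x =ˢ ⊤
  chainsFrom′-head (suc f) {x} (here refl) | true = [] , refl
  chainsFrom′-head (suc f) {x} C∈          | false
    with _ , _ , C∈′ ← find (∈-concatMap⁻ (λ y → map (x ∷_) (chainsFrom′ f y)) {xs = strictlyAbove x} C∈)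
    with C′ , _ , refl ← ∈-map⁻ (x ∷_) C∈′
    = C′ , refl

  SatChain-labels-nonempty : ∀ (lab : Subset m → Subset m → ℕ) {a b G} → SatChain a b G → a ≢ b →
                             ∃[ l ] ∃[ w ] labels lab G ≡ l ∷ w
  SatChain-labels-nonempty lab [ a ]         a≢a = ⊥-elim (a≢a refl)
  SatChain-labels-nonempty lab (a⋖z ∷ chain) _   = _ , _ , labels-∷ lab chain

  between : Subset m → Subset m → Subset m → Bool
  between a b z = (a ⊆ᵇ z) ∧ (z ⊆ᵇ b)

  interval-sound : ∀ a b {z} → z ∈ interval a b → Flat z × a ⊆ z × z ⊆ b
  interval-sound a b {z} z∈ with z∈flats , t ← ∈-filter⁻ (λ z → Data.Bool.T? (between a b z)) {xs = flats} z∈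
    with a⊆z , z⊆b ← Equivalence.to T-∧ t
    = flats-sound z∈flats , ⊆ᵇ-sound a⊆z , ⊆ᵇ-sound z⊆b

  interval-complete : ∀ {a b z} → Flat z → a ⊆ z → z ⊆ b → z ∈ interval a b
  interval-complete {a} {b} flat a⊆z z⊆b = ∈-filter⁺ (λ z → Data.Bool.T? (between a b z)) (flats-complete flat)
    (Equivalence.from T-∧ (⊆ᵇ-complete a⊆z , ⊆ᵇ-complete z⊆b))

  interval-unique : ∀ a b → Unique (interval a b)
  interval-unique a b = Unique.filter⁺ (λ z → Data.Bool.T? (between a b z)) flats-unique

module ChainSums {m : ℕ} (M : Matroid m) (lab : Subset m → Subset m → ℕ) {c ℓ} (R : CommutativeRing c ℓ) where
  open Matroid M
  open LatticeOfFlats M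
  open MatroidFacts M
  open SubsetFacts
  open SaturatedChains M
  open CommutativeRing R
  open ListSums R

  open import Data.Bool using (Bool; true; false; T; _∧_; if_then_else_)
  open import Data.Empty using (⊥-elim)
  open import Data.Fin.Subset using (_⊆_)
  import Data.Fin.Subset.Properties as Subset
  open import Data.List using (List; []; _∷_; map; concatMap)
  open import Data.List.Membership.Propositional using (_∈_)
  open import Data.Nat using (zero; suc; _<_) renaming (_+_ to _+ℕ_)
  import Data.Nat.Properties as ℕ
  open import Data.Product using (∃-syntax; _,_; proj₁; proj₂)
  import Relation.Binary.PropositionalEquality as ≡
  open ≡ using (_≡_; _≢_)
  open import Relation.Nullary using (¬_)
  open import Relation.Binary.Reasoning.Setoid setoid

  ∑-satChains-⊈ : ∀ a b F → ¬ (a ⊆ b) → ∑ (satChains a b) F ≈ 0#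
  ∑-satChains-⊈ a b F a⊈b = ∑-vanish (satChains a b) F λ G G∈ → ⊥-elim (a⊈b (SatChain⇒⊆ (satChains-sound G∈)))

  upperCovers-⊈ : ∀ {a z} → z ∈ upperCovers a → ¬ (z ⊆ a)
  upperCovers-⊈ {a} z∈ z⊆a
    with _ , _ , a⊆z , a≢z , _ ← covers-sound (upperCovers-sound z∈)
    = a≢z (Subset.⊆-antisym a⊆z z⊆a)

  ∑-satChains-step : ∀ a w (F : List (Subset m) → Carrier) →
    ∑ (satChains a w) F ≈ (if a =ˢ w then F (a ∷ []) else 0#) + ∑[ z ∈ upperCovers a ] ∑[ G ∈ satChains z w ] F (a ∷ G)
  ∑-satChains-step a w F rewrite satChains-unfold a w with a =ˢ w in a=w
  ... | true with ≡.refl ← =ˢ-sound {X = a} {Y = w} (≡.subst T (≡.sym a=w) _) =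
    +-congˡ (sym (∑-vanish (upperCovers a) _ λ z z∈ → ∑-satChains-⊈ z a _ (upperCovers-⊈ z∈)))
  ... | false = begin
    ∑ (concatMap (λ z → map (a ∷_) (satChains z w)) (coversBelow a w)) F
      ≈⟨ ∑-concatMap (λ z → map (a ∷_) (satChains z w)) (coversBelow a w) F ⟩
    ∑[ z ∈ coversBelow a w ] ∑ (map (a ∷_) (satChains z w)) F
      ≈⟨ ∑-cong (coversBelow a w) (λ z → reflexive (∑-map (a ∷_) (satChains z w) F)) ⟩
    ∑[ z ∈ coversBelow a w ] S z
      ≈⟨ ∑-filter (λ z → covers a z ∧ (z ⊆ᵇ w)) flats S ⟩
    ∑[ z ∈ flats ] (if covers a z ∧ (z ⊆ᵇ w) then S z else 0#)
      ≈⟨ ∑-cong flats drop-⊆ ⟩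
    ∑[ z ∈ flats ] (if covers a z then S z else 0#)
      ≈⟨ ∑-filter (covers a) flats S ⟨
    ∑[ z ∈ upperCovers a ] S z
      ≈⟨ +-identityˡ _ ⟨
    0# + ∑[ z ∈ upperCovers a ] S z
      ∎
    where
    S : Subset m → Carrier
    S z = ∑[ G ∈ satChains z w ] F (a ∷ G)
    drop-⊆ : ∀ z → (if covers a z ∧ (z ⊆ᵇ w) then S z else 0#) ≈ (if covers a z then S z else 0#)
    drop-⊆ z with covers a z
    ... | false = refl
    ... | true with z ⊆ᵇ w in z⊆w
    ...   | true  = refl
    ...   | false = sym (∑-satChains-⊈ z w _ λ z⊆w′ → ≡.subst T z⊆w (⊆ᵇ-complete z⊆w′))

  chainSum : (List ℕ → Carrier) → Subset m → Subset m → Carrier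
  chainSum g a b = ∑[ G ∈ satChains a b ] g (labels lab G)

  chainSum-⊈ : ∀ g a b → ¬ (a ⊆ b) → chainSum g a b ≈ 0#
  chainSum-⊈ g a b = ∑-satChains-⊈ a b (λ G → g (labels lab G))

  chainSum-refl : ∀ g a → chainSum g a a ≈ g []
  chainSum-refl g a rewrite satChains-refl a = +-identityʳ (g [])

  chainSum-step : ∀ g a w → chainSum g a w ≈
    (if a =ˢ w then g [] else 0#) + ∑[ z ∈ upperCovers a ] chainSum (λ u → g (lab a z ∷ u)) z w
  chainSum-step g a w = trans (∑-satChains-step a w (λ G → g (labels lab G)))
    (+-congˡ (∑-cong (upperCovers a) λ z → ∑-cong-∈ (satChains z w) λ G G∈ →
      reflexive (≡.cong g (labels-∷ lab (satChains-sound G∈)))))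

  ∑-flats-=ˢ : ∀ {a} → Flat a → (f : Subset m → Carrier) → ∑[ w ∈ flats ] (if a =ˢ w then f w else 0#) ≈ f a
  ∑-flats-=ˢ {a} flat f = trans (∑-single flats a _ flats-unique (flats-complete flat) off-a) on-a
    where
    off-a : ∀ w → w ∈ flats → w ≢ a → (if a =ˢ w then f w else 0#) ≈ 0#
    off-a w _ w≢a with a =ˢ w in a=w
    ... | true  = ⊥-elim (w≢a (≡.sym (=ˢ-sound {X = a} (≡.subst T (≡.sym a=w) _))))
    ... | false = refl
    on-a : (if a =ˢ a then f a else 0#) ≈ f a
    on-a with a =ˢ a in a=a
    ... | true  = refl
    ... | false = ⊥-elim (≡.subst T a=a (=ˢ-complete {X = a} ≡.refl))

  chainSum-⋆-unfold : ∀ g h a b → chainSum (g ⋆ h) a b ≈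
    g [] * chainSum h a b + ∑[ z ∈ upperCovers a ] chainSum ((λ u → g (lab a z ∷ u)) ⋆ h) z b
  chainSum-⋆-unfold g h a b = begin
    chainSum (g ⋆ h) a b
      ≈⟨ chainSum-step (g ⋆ h) a b ⟩
    (if a =ˢ b then g [] * h [] else 0#) + ∑[ z ∈ upperCovers a ] chainSum (λ u → (g ⋆ h) (lab a z ∷ u)) z b
      ≈⟨ +-cong (sym (*-if (g []) (a =ˢ b) (h []))) (∑-cong (upperCovers a) split-first) ⟩
    g [] * E + ∑[ z ∈ upperCovers a ] (g [] * H z + G z)
      ≈⟨ +-congˡ (∑-+ (upperCovers a) _ _) ⟩
    g [] * E + (∑[ z ∈ upperCovers a ] (g [] * H z) + ∑ (upperCovers a) G)
      ≈⟨ +-assoc _ _ _ ⟨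
    (g [] * E + ∑[ z ∈ upperCovers a ] (g [] * H z)) + ∑ (upperCovers a) G
      ≈⟨ +-congʳ (trans (+-congˡ (sym (*-distribˡ-∑ (g []) (upperCovers a) H))) (sym (distribˡ _ _ _))) ⟩
    g [] * (E + ∑ (upperCovers a) H) + ∑ (upperCovers a) G
      ≈⟨ +-congʳ (*-congˡ (chainSum-step h a b)) ⟨
    g [] * chainSum h a b + ∑ (upperCovers a) G
      ∎
    where
    E : Carrier
    E = if a =ˢ b then h [] else 0#
    H G : Subset m → Carrier
    H z = chainSum (λ u → h (lab a z ∷ u)) z b
    G z = chainSum ((λ u → g (lab a z ∷ u)) ⋆ h) z b
    split-first : ∀ z → chainSum (λ u → (g ⋆ h) (lab a z ∷ u)) z b ≈ g [] * H z + G z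
    split-first z = trans (∑-+ (satChains z b) _ _) (+-congʳ (sym (*-distribˡ-∑ (g []) (satChains z b) _)))

  ∑-chainSum-*-unfold : ∀ g (C : Subset m → Carrier) {a} → Flat a →
    ∑[ w ∈ flats ] (chainSum g a w * C w) ≈
    g [] * C a + ∑[ z ∈ upperCovers a ] ∑[ w ∈ flats ] (chainSum (λ u → g (lab a z ∷ u)) z w * C w)
  ∑-chainSum-*-unfold g C {a} flat = begin
    ∑[ w ∈ flats ] (chainSum g a w * C w)
      ≈⟨ ∑-cong flats (λ w → trans (*-congʳ (chainSum-step g a w)) (distribʳ _ _ _)) ⟩
    ∑[ w ∈ flats ] ((if a =ˢ w then g [] else 0#) * C w + ∑[ z ∈ upperCovers a ] G z w * C w)
      ≈⟨ ∑-+ flats _ _ ⟩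
    ∑[ w ∈ flats ] ((if a =ˢ w then g [] else 0#) * C w) + ∑[ w ∈ flats ] (∑[ z ∈ upperCovers a ] G z w * C w)
      ≈⟨ +-cong (trans (∑-cong flats λ w → if-* (a =ˢ w) (g []) (C w)) (∑-flats-=ˢ flat λ w → g [] * C w))
                (∑-cong flats λ w → *-distribʳ-∑ (C w) (upperCovers a) λ z → G z w) ⟩
    g [] * C a + ∑[ w ∈ flats ] ∑[ z ∈ upperCovers a ] (G z w * C w)
      ≈⟨ +-congˡ (∑-comm flats (upperCovers a) _) ⟩
    g [] * C a + ∑[ z ∈ upperCovers a ] ∑[ w ∈ flats ] (G z w * C w)
      ∎
    where
    G : Subset m → Subset m → Carrier
    G z w = chainSum (λ u → g (lab a z ∷ u)) z w

  -- g ↦ chainSum g turns the convolution of words into the convolution of the incidence algebra.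
  chainSum-⋆ : ∀ g h a b → Flat a → chainSum (g ⋆ h) a b ≈ ∑[ w ∈ flats ] (chainSum g a w * chainSum h w b)
  chainSum-⋆ g h a b flat = go (suc m) g flat (ℕ.m≤n+m (suc m) (r a))
    where
    C : Subset m → Carrier
    C w = chainSum h w b
    go : ∀ n g {a} → Flat a → m < r a +ℕ n → chainSum (g ⋆ h) a b ≈ ∑[ w ∈ flats ] (chainSum g a w * C w)
    go zero    g {a} _    m< = ⊥-elim (m≮r+0 a m<)
    go (suc n) g {a} flat m< = begin
      chainSum (g ⋆ h) a b
        ≈⟨ chainSum-⋆-unfold g h a b ⟩
      g [] * C a + ∑[ z ∈ upperCovers a ] chainSum ((λ u → g (lab a z ∷ u)) ⋆ h) z b
        ≈⟨ +-congˡ (∑-cong-∈ (upperCovers a) λ z z∈ → go n (λ u → g (lab a z ∷ u)) (covers⇒flatʳ z∈) (fuel z∈)) ⟩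
      g [] * C a + ∑[ z ∈ upperCovers a ] ∑[ w ∈ flats ] (chainSum (λ u → g (lab a z ∷ u)) z w * C w)
        ≈⟨ ∑-chainSum-*-unfold g C flat ⟨
      ∑[ w ∈ flats ] (chainSum g a w * C w)
        ∎
      where
      covers⇒flatʳ : ∀ {z} → z ∈ upperCovers a → Flat z
      covers⇒flatʳ z∈ = proj₁ (proj₂ (covers-sound (upperCovers-sound z∈)))
      fuel : ∀ {z} → z ∈ upperCovers a → m < r z +ℕ n
      fuel z∈ rewrite covers⇒rank-suc (upperCovers-sound z∈) = ≡.subst (m <_) (ℕ.+-suc (r a) n) m<

  chainSum-weaklyIncreasing : IsRLabeling lab → ∀ {a b} → Flat a → Flat b → a ⊆ b →
    chainSum (λ w → if weaklyIncreasing w then 1# else 0#) a b ≈ 1#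
  chainSum-weaklyIncreasing isR {a} {b} flatA flatB a⊆b
    with G₀ , (G₀∈ , G₀↑) , unique ← isR a b (flats-complete flatA) (flats-complete flatB) a⊆b =
    trans (∑-single (satChains a b) G₀ _ (satChains-unique a b) G₀∈ others) (reflexive (T⇒if≡ G₀↑))
    where
    T⇒if≡ : ∀ {t} → T t → (if t then 1# else 0#) ≡ 1#
    T⇒if≡ {true} _ = ≡.refl
    others : ∀ G → G ∈ satChains a b → G ≢ G₀ → (if weaklyIncreasing (labels lab G) then 1# else 0#) ≈ 0#
    others G G∈ G≢G₀ with weaklyIncreasing (labels lab G) in G↑
    ... | true  = ⊥-elim (G≢G₀ (unique G G∈ (≡.subst T (≡.sym G↑) _)))
    ... | false = refl

  chainSum-nonempty : ∀ {f g} a b → a ≢ b → (∀ l w → f (l ∷ w) ≈ g (l ∷ w)) → chainSum f a b ≈ chainSum g a b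
  chainSum-nonempty {f} {g} a b a≢b f≈g = ∑-cong-∈ (satChains a b) λ G G∈ → agree (labels lab G)
    (SatChain-labels-nonempty lab (satChains-sound G∈) a≢b)
    where
    agree : ∀ w → ∃[ l ] ∃[ u ] w ≡ l ∷ u → f w ≈ g w
    agree w (l , u , ≡.refl) = f≈g l u

module NatBooleanComparisons where
  open import Data.Bool using (true; false; T)
  open import Data.Empty using (⊥-elim)
  open import Data.Nat using (_≤ᵇ_; _<ᵇ_)
  import Data.Nat.Properties as ℕ
  open import Relation.Binary.PropositionalEquality using (_≡_; refl; sym; subst)

  <ᵇ⇒≤ᵇ≡false : ∀ l p → (l <ᵇ p) ≡ true → (p ≤ᵇ l) ≡ false
  <ᵇ⇒≤ᵇ≡false l p l<p with p ≤ᵇ l in p≤l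
  ... | false = refl
  ... | true  = ⊥-elim (ℕ.<⇒≱ (ℕ.<ᵇ⇒< l p (subst T (sym l<p) _)) (ℕ.≤ᵇ⇒≤ p l (subst T (sym p≤l) _)))

  ≮ᵇ⇒≤ᵇ≡true : ∀ l p → (l <ᵇ p) ≡ false → (p ≤ᵇ l) ≡ true
  ≮ᵇ⇒≤ᵇ≡true l p l≮p with p ≤ᵇ l in p≤l
  ... | true  = refl
  ... | false = ⊥-elim (subst T l≮p (ℕ.<⇒<ᵇ {l} {p} (ℕ.≰⇒> λ p≤l′ → subst T p≤l (ℕ.≤⇒≤ᵇ {p} {l} p≤l′))))

-- The descent statistics of Defs live inside LatticeOfFlats M, hence the matroid parameter.
module LabelWords {m : ℕ} (M : Matroid m) {c ℓ} (R : CommutativeRing c ℓ) (X : CommutativeRing.Carrier R) where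
  open LatticeOfFlats M using (weaklyIncreasing; descents; count; isolated)
  open NatBooleanComparisons
  open CommutativeRing R
  open ListSums R
  open import Algebra.Properties.Semiring.Exp semiring using (_^_)
  open import Algebra.Properties.Ring ring using (-‿distribʳ-*; -1*x≈-x)
  open import Data.Bool using (Bool; true; false; T; _∧_; if_then_else_)
  open import Data.List using (List; []; _∷_; length)
  open import Data.Maybe using (nothing)
  import Algebra.Solver.Ring.NaturalCoefficients commutativeSemiring (λ _ _ → nothing) as Solver
  open import Data.Nat using (suc; _≤_; _∸_; _≤ᵇ_; _<ᵇ_; z≤n; s≤s) renaming (_*_ to _*ℕ_)
  import Data.Nat.Properties as ℕ
  import Relation.Binary.PropositionalEquality as ≡
  open ≡ using (_≡_)
  open import Relation.Binary.Reasoning.Setoid setoid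

  incrFrom : ℕ → List ℕ → Carrier
  incrFrom p []      = 1#
  incrFrom p (l ∷ w) = if p ≤ᵇ l then X * incrFrom l w else 0#

  incr : List ℕ → Carrier
  incr []      = 1#
  incr (p ∷ w) = X * incrFrom p w

  decrFrom : ℕ → List ℕ → Carrier
  decrFrom p []      = 1#
  decrFrom p (l ∷ w) = if l <ᵇ p then - decrFrom l w else 0#

  decr : List ℕ → Carrier
  decr []      = 1#
  decr (p ∷ w) = - decrFrom p w

  -- A word p ∷ w that strictly decreases for k steps and then weakly increases has
  -- valley weight (-1) ^ k * X ^ (length w - k); every other word has weight 0.
  valleyFrom : ℕ → List ℕ → Carrier
  valleyFrom p []      = 1#
  valleyFrom p (l ∷ w) = if l <ᵇ p then - valleyFrom l w else X * incrFrom l w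

  valley : List ℕ → Carrier
  valley []      = 0#
  valley (p ∷ w) = valleyFrom p w

  -- valleys w sums, over the factorisations of w into valleys, the product of their weights;
  -- valleys↓ and valleys↑ read the current valley while it still decreases and once it rises.
  valleys↓ valleys↑ : ℕ → List ℕ → Carrier
  valleys↓ p []      = 1#
  valleys↓ p (l ∷ w) = valleys↓ l w + (if l <ᵇ p then - valleys↓ l w else X * valleys↑ l w)
  valleys↑ p []      = 1#
  valleys↑ p (l ∷ w) = valleys↓ l w + (if p ≤ᵇ l then X * valleys↑ l w else 0#)

  valleys : List ℕ → Carrier
  valleys []      = 1#
  valleys (p ∷ w) = valleys↓ p w

  incrFrom-≈ : ∀ p w → incrFrom p w ≈ (if weaklyIncreasing (p ∷ w) then X ^ length w else 0#)
  incrFrom-≈ p []      = refl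
  incrFrom-≈ p (l ∷ w) = step (p ≤ᵇ l)
    where
    step : ∀ b → (if b then X * incrFrom l w else 0#) ≈
                 (if b ∧ weaklyIncreasing (l ∷ w) then X ^ suc (length w) else 0#)
    step true  = trans (*-congˡ (incrFrom-≈ l w)) (*-if X (weaklyIncreasing (l ∷ w)) _)
    step false = refl

  incr-≈ : ∀ w → incr w ≈ (if weaklyIncreasing w then X ^ length w else 0#)
  incr-≈ []      = refl
  incr-≈ (p ∷ w) = trans (*-congˡ (incrFrom-≈ p w)) (*-if X (weaklyIncreasing (p ∷ w)) _)

  X*incrFrom-decrFrom⋆incr : ∀ p w → X * incrFrom p w + - (decrFrom p ⋆ incr) w ≈ (X + - 1#) * valleyFrom p w
  X*incrFrom-decrFrom⋆incr p []      = begin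
    X * 1# + - (1# * 1#)  ≈⟨ +-cong (*-identityʳ X) (-‿cong (*-identityˡ 1#)) ⟩
    X + - 1#              ≈⟨ *-identityʳ _ ⟨
    (X + - 1#) * 1#       ∎
  X*incrFrom-decrFrom⋆incr p (l ∷ w) with l <ᵇ p in l<p
  ... | true  rewrite <ᵇ⇒≤ᵇ≡false l p l<p = begin
    X * 0# + - (1# * (X * incrFrom l w) + ((λ u → - decrFrom l u) ⋆ incr) w)
      ≈⟨ +-cong (zeroʳ X) (-‿cong (+-cong (*-identityˡ _) (⋆-negˡ (decrFrom l) incr w))) ⟩
    0# + - (X * incrFrom l w + - (decrFrom l ⋆ incr) w)
      ≈⟨ +-identityˡ _ ⟩
    - (X * incrFrom l w + - (decrFrom l ⋆ incr) w)
      ≈⟨ -‿cong (X*incrFrom-decrFrom⋆incr l w) ⟩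
    - ((X + - 1#) * valleyFrom l w)
      ≈⟨ -‿distribʳ-* _ _ ⟩
    (X + - 1#) * - valleyFrom l w
      ∎
  ... | false rewrite ≮ᵇ⇒≤ᵇ≡true l p l<p = begin
    X * (X * incrFrom l w) + - (1# * (X * incrFrom l w) + ((λ _ → 0#) ⋆ incr) w)
      ≈⟨ +-congˡ (-‿cong (trans (+-cong (*-identityˡ _) (⋆-zeroˡ incr w)) (+-identityʳ _))) ⟩
    X * (X * incrFrom l w) + - (X * incrFrom l w)
      ≈⟨ +-congˡ (sym (-1*x≈-x _)) ⟩
    X * (X * incrFrom l w) + - 1# * (X * incrFrom l w)
      ≈⟨ distribʳ _ _ _ ⟨
    (X + - 1#) * (X * incrFrom l w)
      ∎

  -- The factor x - 1 of the characteristic polynomial.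
  decr⋆incr-∷ : ∀ p w → (decr ⋆ incr) (p ∷ w) ≈ (X + - 1#) * valley (p ∷ w)
  decr⋆incr-∷ p w =
    trans (+-cong (*-identityˡ _) (⋆-negˡ (decrFrom p) incr w)) (X*incrFrom-decrFrom⋆incr p w)

  valleys↓-⋆ : ∀ p w → valleys↓ p w ≈ (valleyFrom p ⋆ valleys) w
  valleys↑-⋆ : ∀ p w → valleys↑ p w ≈ (incrFrom p ⋆ valleys) w
  valleys↓-⋆ p []      = sym (*-identityˡ 1#)
  valleys↓-⋆ p (l ∷ w) = +-cong (sym (*-identityˡ _)) (step (l <ᵇ p))
    where
    step : ∀ b → (if b then - valleys↓ l w else X * valleys↑ l w) ≈
                 ((λ u → if b then - valleyFrom l u else X * incrFrom l u) ⋆ valleys) w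
    step true  = trans (-‿cong (valleys↓-⋆ l w)) (sym (⋆-negˡ (valleyFrom l) valleys w))
    step false = trans (*-congˡ (valleys↑-⋆ l w)) (sym (⋆-*ˡ X (incrFrom l) valleys w))
  valleys↑-⋆ p []      = sym (*-identityˡ 1#)
  valleys↑-⋆ p (l ∷ w) = +-cong (sym (*-identityˡ _)) (step (p ≤ᵇ l))
    where
    step : ∀ b → (if b then X * valleys↑ l w else 0#) ≈
                 ((λ u → if b then X * incrFrom l u else 0#) ⋆ valleys) w
    step true  = trans (*-congˡ (valleys↑-⋆ l w)) (sym (⋆-*ˡ X (incrFrom l) valleys w))
    step false = sym (⋆-zeroˡ valleys w)

  valleys-⋆ : ∀ p w → valleys (p ∷ w) ≈ (valley ⋆ valleys) (p ∷ w)
  valleys-⋆ p w = trans (valleys↓-⋆ p w) (sym (trans (+-congʳ (zeroˡ _)) (+-identityˡ _)))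

  -- The summand of the theorem for a word of length suc (length ds) whose descent indicators are ds.
  descentWeight : List Bool → Carrier
  descentWeight ds =
    if isolated ds then X ^ count ds * (X + 1#) ^ (suc (length ds) ∸ 2 *ℕ count ds) else 0#

  isolated⇒2*count≤ : ∀ ds → T (isolated ds) → 2 *ℕ count ds ≤ suc (length ds)
  isolated⇒2*count≤ []                  _ = z≤n
  isolated⇒2*count≤ (true ∷ [])         _ = s≤s (s≤s z≤n)
  isolated⇒2*count≤ (true ∷ false ∷ ds) t rewrite ℕ.*-suc 2 (count ds) = s≤s (s≤s (isolated⇒2*count≤ ds t))
  isolated⇒2*count≤ (false ∷ ds)        t = ℕ.m≤n⇒m≤1+n (isolated⇒2*count≤ ds t)

  descentWeight-[] : descentWeight [] ≈ X + 1#
  descentWeight-[] = Solver.solve 1 (λ x → con 1 :* ((x :+ con 1) :* con 1) := x :+ con 1) refl X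
    where open Solver

  descentWeight-false : ∀ ds → descentWeight (false ∷ ds) ≈ (X + 1#) * descentWeight ds
  descentWeight-false ds with isolated ds in iso
  ... | false = sym (zeroʳ _)
  ... | true  = begin
    X ^ k * (X + 1#) ^ (suc (suc n) ∸ 2 *ℕ k)         ≡⟨ ≡.cong (λ e → X ^ k * (X + 1#) ^ e) exponent ⟩
    X ^ k * ((X + 1#) * (X + 1#) ^ (suc n ∸ 2 *ℕ k))  ≈⟨ x∙yz≈y∙xz (X ^ k) (X + 1#) _ ⟩
    (X + 1#) * (X ^ k * (X + 1#) ^ (suc n ∸ 2 *ℕ k))  ∎
    where
    open import Algebra.Properties.CommutativeSemigroup *-commutativeSemigroup using (x∙yz≈y∙xz)
    k n : ℕ
    k = count ds
    n = length ds
    exponent : suc (suc n) ∸ 2 *ℕ k ≡ suc (suc n ∸ 2 *ℕ k)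
    exponent = ℕ.+-∸-assoc 1 (isolated⇒2*count≤ ds (≡.subst T (≡.sym iso) _))

  descentWeight-true-[] : descentWeight (true ∷ []) ≈ X
  descentWeight-true-[] = trans (*-identityʳ _) (*-identityʳ X)

  descentWeight-true-false : ∀ ds → descentWeight (true ∷ false ∷ ds) ≈ X * descentWeight ds
  descentWeight-true-false ds with isolated ds
  ... | false = sym (zeroʳ X)
  ... | true  = begin
    X ^ suc k * (X + 1#) ^ (suc (suc (suc n)) ∸ 2 *ℕ suc k)  ≡⟨ ≡.cong (λ e → X ^ suc k * (X + 1#) ^ (suc (suc (suc n)) ∸ e))
                                                                     (ℕ.*-suc 2 k) ⟩
    (X * X ^ k) * (X + 1#) ^ (suc n ∸ 2 *ℕ k)                 ≈⟨ *-assoc _ _ _ ⟩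
    X * (X ^ k * (X + 1#) ^ (suc n ∸ 2 *ℕ k))                 ∎
    where
    k n : ℕ
    k = count ds
    n = length ds

  -- The weight left for the rest of a word once a descent has been read.
  afterDescent : ℕ → List ℕ → Carrier
  afterDescent p []      = 1#
  afterDescent p (l ∷ w) = if l <ᵇ p then 0# else descentWeight (descents (l ∷ w))

  X*afterDescent : ∀ p w → X * afterDescent p w ≈ descentWeight (true ∷ descents (p ∷ w))
  X*afterDescent p []      = trans (*-identityʳ X) (sym descentWeight-true-[])
  X*afterDescent p (l ∷ w) with l <ᵇ p
  ... | true  = zeroʳ X
  ... | false = sym (descentWeight-true-false (descents (l ∷ w)))

  valleys↓-closed : ∀ p w → valleys↓ p w ≈ afterDescent p w
  valleys-closed  : ∀ p w → valleys↓ p w + X * valleys↑ p w ≈ descentWeight (descents (p ∷ w))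
  valleys↓-closed p []      = refl
  valleys↓-closed p (l ∷ w) with l <ᵇ p
  ... | true  = -‿inverseʳ _
  ... | false = valleys-closed l w
  valleys-closed p []      = trans (+-congˡ (*-identityʳ X)) (trans (+-comm 1# X) (sym descentWeight-[]))
  valleys-closed p (l ∷ w) with l <ᵇ p in l<p
  ... | true rewrite <ᵇ⇒≤ᵇ≡false l p l<p = begin
    (valleys↓ l w + - valleys↓ l w) + X * (valleys↓ l w + 0#)  ≈⟨ +-cong (-‿inverseʳ _) (*-congˡ (+-identityʳ _)) ⟩
    0# + X * valleys↓ l w                                     ≈⟨ +-identityˡ _ ⟩
    X * valleys↓ l w                                          ≈⟨ *-congˡ (valleys↓-closed l w) ⟩
    X * afterDescent l w                                      ≈⟨ X*afterDescent l w ⟩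
    descentWeight (true ∷ descents (l ∷ w))                   ∎
  ... | false rewrite ≮ᵇ⇒≤ᵇ≡true l p l<p = begin
    (valleys↓ l w + X * valleys↑ l w) + X * (valleys↓ l w + X * valleys↑ l w)
      ≈⟨ +-cong (valleys-closed l w) (*-congˡ (valleys-closed l w)) ⟩
    descentWeight (descents (l ∷ w)) + X * descentWeight (descents (l ∷ w))
      ≈⟨ Solver.solve 2 (λ x y → y :+ x :* y := (x :+ con 1) :* y) refl X _ ⟩
    (X + 1#) * descentWeight (descents (l ∷ w))
      ≈⟨ descentWeight-false (descents (l ∷ w)) ⟨
    descentWeight (false ∷ descents (l ∷ w))
      ∎
    where open Solver

  isolatedDescentWeight : List ℕ → Carrier
  isolatedDescentWeight w =
    if isolated (descents w) then X ^ count (descents w) * (X + 1#) ^ (length w ∸ 2 *ℕ count (descents w)) else 0#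

  length-descents : ∀ p w → length (descents (p ∷ w)) ≡ length w
  length-descents p []      = ≡.refl
  length-descents p (l ∷ w) = ≡.cong suc (length-descents l w)

  incr⋆valleys : ∀ w → (incr ⋆ valleys) w ≈ isolatedDescentWeight w
  incr⋆valleys []      = trans (*-identityˡ 1#) (sym (*-identityˡ 1#))
  incr⋆valleys (p ∷ w) = begin
    1# * valleys↓ p w + ((λ u → X * incrFrom p u) ⋆ valleys) w  ≈⟨ +-cong (*-identityˡ _) (⋆-*ˡ X (incrFrom p) valleys w) ⟩
    valleys↓ p w + X * (incrFrom p ⋆ valleys) w                ≈⟨ +-congˡ (*-congˡ (valleys↑-⋆ p w)) ⟨
    valleys↓ p w + X * valleys↑ p w                            ≈⟨ valleys-closed p w ⟩
    descentWeight (descents (p ∷ w))                           ≡⟨ ≡.cong (λ n → if isolated ds then X ^ count ds * (X + 1#) ^ (suc n ∸ 2 *ℕ count ds) else 0#)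
                                                                          (length-descents p w) ⟩
    isolatedDescentWeight (p ∷ w)                              ∎
    where
    ds : List Bool
    ds = descents (p ∷ w)

module RLabelingSums {m : ℕ} (M : Matroid m) (lab : Subset m → Subset m → ℕ)
                     (isR : LatticeOfFlats.IsRLabeling M lab)
                     {c ℓ} (R : CommutativeRing c ℓ) (X : CommutativeRing.Carrier R) where
  open Matroid M
  open LatticeOfFlats M
  open MatroidFacts M
  open SubsetFacts
  open SaturatedChains M
  open CommutativeRing R
  open ListSums R
  open ChainSums M lab R
  open LabelWords M R X
  open import Algebra.Properties.Semiring.Exp semiring using (_^_)

  open import Data.Bool using (Bool; true; false; T; _∧_; if_then_else_)
  open import Data.Fin.Subset using (_⊆_)
  open import Data.List using (length)
  open import Data.List.Membership.Propositional using (_∈_)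
  open import Data.Nat using (_∸_)
  import Data.Nat.Properties as ℕ
  import Relation.Binary.PropositionalEquality as ≡
  open ≡ using (_≡_; _≢_)
  open import Relation.Binary.Reasoning.Setoid setoid

  -- Only the increasing chain of an interval survives.
  chainSum-incr : ∀ {a b} → Flat a → Flat b → a ⊆ b → chainSum incr a b ≈ X ^ (r b ∸ r a)
  chainSum-incr {a} {b} flatA flatB a⊆b = begin
    chainSum incr a b
      ≈⟨ ∑-cong-∈ (satChains a b) (λ G G∈ → trans (incr-≈ (labels lab G)) (by-length G∈ (weaklyIncreasing (labels lab G)))) ⟩
    ∑[ G ∈ satChains a b ] ((if weaklyIncreasing (labels lab G) then 1# else 0#) * X ^ (r b ∸ r a))
      ≈⟨ *-distribʳ-∑ _ (satChains a b) _ ⟨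
    chainSum (λ w → if weaklyIncreasing w then 1# else 0#) a b * X ^ (r b ∸ r a)
      ≈⟨ *-congʳ (chainSum-weaklyIncreasing isR flatA flatB a⊆b) ⟩
    1# * X ^ (r b ∸ r a)
      ≈⟨ *-identityˡ _ ⟩
    X ^ (r b ∸ r a)
      ∎
    where
    by-length : ∀ {G} → G ∈ satChains a b → ∀ t →
      (if t then X ^ length (labels lab G) else 0#) ≈ (if t then 1# else 0#) * X ^ (r b ∸ r a)
    by-length {G} G∈ true  = trans (reflexive (≡.cong (X ^_) length≡)) (sym (*-identityˡ _))
      where
      length≡ : length (labels lab G) ≡ r b ∸ r a
      length≡ = ≡.sym (≡.trans (≡.cong (_∸ r a) (≡.sym (SatChain-length lab (satChains-sound G∈)))) (ℕ.m+n∸n≡m _ (r a)))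
    by-length G∈ false = sym (zeroˡ _)

  -- Split every maximal chain of [a , b] at F into a decreasing and an increasing part.
  ∑-interval-decr : ∀ {a b} → Flat a → Flat b → a ⊆ b → a ≢ b →
    ∑[ F ∈ interval a b ] (chainSum decr a F * X ^ (r b ∸ r F)) ≈ (X + - 1#) * chainSum valley a b
  ∑-interval-decr {a} {b} flatA flatB a⊆b a≢b = begin
    ∑[ F ∈ interval a b ] (chainSum decr a F * X ^ (r b ∸ r F))
      ≈⟨ ∑-filter (λ F → (a ⊆ᵇ F) ∧ (F ⊆ᵇ b)) flats _ ⟩
    ∑[ F ∈ flats ] (if (a ⊆ᵇ F) ∧ (F ⊆ᵇ b) then chainSum decr a F * X ^ (r b ∸ r F) else 0#)
      ≈⟨ ∑-cong-∈ flats (λ F F∈ → through (flats-sound F∈)) ⟩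
    ∑[ F ∈ flats ] (chainSum decr a F * chainSum incr F b)
      ≈⟨ chainSum-⋆ decr incr a b flatA ⟨
    chainSum (decr ⋆ incr) a b
      ≈⟨ chainSum-nonempty {decr ⋆ incr} {λ w → (X + - 1#) * valley w} a b a≢b decr⋆incr-∷ ⟩
    chainSum (λ w → (X + - 1#) * valley w) a b
      ≈⟨ *-distribˡ-∑ _ (satChains a b) _ ⟨
    (X + - 1#) * chainSum valley a b
      ∎
    where
    through : ∀ {F} → Flat F →
      (if (a ⊆ᵇ F) ∧ (F ⊆ᵇ b) then chainSum decr a F * X ^ (r b ∸ r F) else 0#) ≈ chainSum decr a F * chainSum incr F b
    through {F} flatF with a ⊆ᵇ F in a⊆F | F ⊆ᵇ b in F⊆b
    ... | true  | true  = *-congˡ (sym (chainSum-incr flatF flatB (⊆ᵇ-sound (≡.subst T (≡.sym F⊆b) _))))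
    ... | true  | false = sym (trans (*-congˡ (chainSum-⊈ incr F b λ F⊆b′ → ≡.subst T F⊆b (⊆ᵇ-complete F⊆b′))) (zeroʳ _))
    ... | false | _     = sym (trans (*-congʳ (chainSum-⊈ decr a F λ a⊆F′ → ≡.subst T a⊆F (⊆ᵇ-complete a⊆F′))) (zeroˡ _))

module MobiusFunction {m : ℕ} (M : Matroid m) (lab : Subset m → Subset m → ℕ)
                      (isR : LatticeOfFlats.IsRLabeling M lab) where
  open import Data.Integer using (ℤ; 0ℤ; 1ℤ; _+_; _*_; -_)
  import Data.Integer.Properties as ℤ
  open Matroid M
  open LatticeOfFlats M
  open MatroidFacts M
  open SubsetFacts
  open SaturatedChains M
  open ListSums ℤ.+-*-commutativeRing
  open ChainSums M lab ℤ.+-*-commutativeRing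
  open LabelWords M ℤ.+-*-commutativeRing 1ℤ
  open RLabelingSums M lab isR ℤ.+-*-commutativeRing 1ℤ
  open import Algebra.Properties.Semiring.Exp ℤ.+-*-semiring using (_^_)
  open import Algebra.Properties.AbelianGroup ℤ.+-0-abelianGroup using (inverseʳ-unique)

  open import Data.Bool using (Bool; true; false; T; not; if_then_else_)
  open import Data.Empty using (⊥-elim)
  open import Data.Fin.Subset using (_⊆_)
  open import Data.List using (List; map; filter; foldr)
  open import Data.List.Membership.Propositional using (_∈_)
  open import Data.List.Membership.Propositional.Properties using (∈-filter⁻)
  open import Data.Nat using (zero; suc; _<_; _∸_; s≤s)
  import Data.Nat.Properties as ℕ
  open import Data.Product using (_,_)
  open import Relation.Binary.PropositionalEquality
  open import Relation.Nullary using (¬_; Dec; yes; no)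
  open import Data.Fin.Subset.Properties using (_⊆?_)
  open import Data.Vec.Properties using (≡-dec)
  import Data.Bool
  import Data.Bool.Properties

  1^n≡1 : ∀ n → 1ℤ ^ n ≡ 1ℤ
  1^n≡1 zero    = refl
  1^n≡1 (suc n) = trans (ℤ.*-identityˡ _) (1^n≡1 n)

  ∑-interval-decr≡0 : ∀ {a b} → Flat a → Flat b → a ⊆ b → a ≢ b → ∑ (interval a b) (chainSum decr a) ≡ 0ℤ
  ∑-interval-decr≡0 {a} {b} flatA flatB a⊆b a≢b =
    trans (∑-cong (interval a b) λ F → sym (trans (cong (chainSum decr a F *_) (1^n≡1 (r b ∸ r F))) (ℤ.*-identityʳ _)))
          (∑-interval-decr flatA flatB a⊆b a≢b)

  μ′-refl : ∀ f a → μ′ (suc f) a a ≡ 1ℤ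
  μ′-refl f a with a =ˢ a in a=a
  ... | true  = refl
  ... | false = ⊥-elim (subst T a=a (=ˢ-complete {X = a} refl))

  μ′-⊈ : ∀ f {a y} → ¬ (a ⊆ y) → μ′ (suc f) a y ≡ 0ℤ
  μ′-⊈ f {a} {y} a⊈y with a =ˢ y in a=y
  ... | true  = ⊥-elim (a⊈y (subst (a ⊆_) (=ˢ-sound (subst T (sym a=y) _)) (λ x∈ → x∈)))
  ... | false with a ⊆ᵇ y in a⊆y
  ...   | true  = ⊥-elim (a⊈y (⊆ᵇ-sound (subst T (sym a⊆y) _)))
  ...   | false = refl

  μ′-⊂ : ∀ f {a y} → a ⊆ y → a ≢ y →
    μ′ (suc f) a y ≡ - foldr _+_ 0ℤ (map (μ′ f a) (filter (λ z → Data.Bool.T? (not (z =ˢ y))) (interval a y)))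
  μ′-⊂ f {a} {y} a⊆y a≢y with a =ˢ y in a=y
  ... | true  = ⊥-elim (a≢y (=ˢ-sound (subst T (sym a=y) _)))
  ... | false with a ⊆ᵇ y in a⊆ᵇy
  ...   | true  = refl
  ...   | false = ⊥-elim (subst T a⊆ᵇy (⊆ᵇ-complete a⊆y))

  other : Subset m → Subset m → Bool
  other y z = not (z =ˢ y)

  -- The defining recursion of μ.
  chainSum-decr-recursion : ∀ {a y} → Flat a → Flat y → a ⊆ y → a ≢ y →
    chainSum decr a y ≡ - ∑ (filter (λ z → Data.Bool.T? (other y z)) (interval a y)) (chainSum decr a)
  chainSum-decr-recursion {a} {y} flatA flatY a⊆y a≢y = inverseʳ-unique _ _ (begin
    ∑ (filter (λ z → Data.Bool.T? (other y z)) I) Möbius + Möbius y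
      ≡⟨ cong₂ _+_ (∑-filter (other y) I Möbius) (sym y-term) ⟩
    ∑[ z ∈ I ] (if other y z then Möbius z else 0ℤ) + ∑[ z ∈ I ] (if z =ˢ y then Möbius z else 0ℤ)
      ≡⟨ sym (∑-+ I _ _) ⟩
    ∑[ z ∈ I ] ((if other y z then Möbius z else 0ℤ) + (if z =ˢ y then Möbius z else 0ℤ))
      ≡⟨ ∑-cong I split ⟩
    ∑ I Möbius
      ≡⟨ ∑-interval-decr≡0 flatA flatY a⊆y a≢y ⟩
    0ℤ
      ∎)
    where
    open ≡-Reasoning
    I : List (Subset m)
    I = interval a y
    Möbius : Subset m → ℤ
    Möbius = chainSum decr a
    y-term : ∑[ z ∈ I ] (if z =ˢ y then Möbius z else 0ℤ) ≡ Möbius y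
    y-term = trans (∑-single I y _ (interval-unique a y) (interval-complete flatY a⊆y (λ x∈ → x∈)) off-y) on-y
      where
      off-y : ∀ z → z ∈ I → z ≢ y → (if z =ˢ y then Möbius z else 0ℤ) ≡ 0ℤ
      off-y z _ z≢y with z =ˢ y in z=y
      ... | true  = ⊥-elim (z≢y (=ˢ-sound (subst T (sym z=y) _)))
      ... | false = refl
      on-y : (if y =ˢ y then Möbius y else 0ℤ) ≡ Möbius y
      on-y with y =ˢ y in y=y
      ... | true  = refl
      ... | false = ⊥-elim (subst T y=y (=ˢ-complete {X = y} refl))
    split : ∀ z → (if other y z then Möbius z else 0ℤ) + (if z =ˢ y then Möbius z else 0ℤ) ≡ Möbius z
    split z with z =ˢ y
    ... | true  = ℤ.+-identityˡ _
    ... | false = ℤ.+-identityʳ _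

  μ′≡chainSum-decr : ∀ f {a y} → Flat a → Flat y → r y < f → μ′ f a y ≡ chainSum decr a y
  μ′≡chainSum-decr (suc f) {a} {y} flatA flatY ry<f = by-cases (≡-dec Data.Bool.Properties._≟_ a y) (a ⊆? y)
    where
    I′ : List (Subset m)
    I′ = filter (λ z → Data.Bool.T? (other y z)) (interval a y)
    ih : ∀ z → z ∈ I′ → μ′ f a z ≡ chainSum decr a z
    ih z z∈ with z∈I , z≠y ← ∈-filter⁻ (λ z → Data.Bool.T? (other y z)) {xs = interval a y} z∈
      with flatZ , _ , z⊆y ← interval-sound a y z∈I =
      μ′≡chainSum-decr f flatA flatZ (ℕ.<-≤-trans (flat-rank-strict flatZ z⊆y λ z≡y → T-not⇒¬T z≠y (=ˢ-complete z≡y))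
                                                   (ℕ.≤-pred ry<f))
    by-cases : Dec (a ≡ y) → Dec (a ⊆ y) → μ′ (suc f) a y ≡ chainSum decr a y
    by-cases (yes refl) _        = trans (μ′-refl f a) (sym (chainSum-refl decr a))
    by-cases (no a≢y) (no a⊈y)  = trans (μ′-⊈ f a⊈y) (sym (chainSum-⊈ decr a y a⊈y))
    by-cases (no a≢y) (yes a⊆y) = begin
      μ′ (suc f) a y                       ≡⟨ μ′-⊂ f a⊆y a≢y ⟩
      - foldr _+_ 0ℤ (map (μ′ f a) I′)     ≡⟨ cong -_ (trans (foldr-+-map (μ′ f a) I′) (∑-cong-∈ I′ ih)) ⟩
      - ∑ I′ (chainSum decr a)             ≡⟨ chainSum-decr-recursion flatA flatY a⊆y a≢y ⟨
      chainSum decr a y                    ∎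
      where open ≡-Reasoning

  μ≡chainSum-decr : ∀ {a y} → Flat a → Flat y → μ a y ≡ chainSum decr a y
  μ≡chainSum-decr {y = y} flatA flatY = μ′≡chainSum-decr (suc m) flatA flatY (s≤s (r≤m y))

module AugmentedChow {m : ℕ} (M : Matroid m) (loopless : Loopless M) (lab : Subset m → Subset m → ℕ)
                     (isR : LatticeOfFlats.IsRLabeling M lab) where
  open import Data.Integer as ℤ using (ℤ; 1ℤ)
  import Data.Integer.Properties as ℤ
  open Matroid M
  open LatticeOfFlats M
  open MatroidFacts M
  open SubsetFacts
  open SaturatedChains M
  open PolynomialRing
  open PolynomialFacts
  open CommutativeRing commutativeRing using (setoid)
  open ListSums commutativeRing
  open ChainSums M lab commutativeRing
  open LabelWords M commutativeRing Xₚ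
  open RLabelingSums M lab isR commutativeRing Xₚ
  open MobiusFunction M lab isR using (μ≡chainSum-decr)
  module ℤWords = LabelWords M ℤ.+-*-commutativeRing 1ℤ
  module ℤChains = ChainSums M lab ℤ.+-*-commutativeRing
  open import Algebra.Properties.Semiring.Exp (CommutativeRing.semiring commutativeRing) using (_^_)

  open import Data.Bool using (Bool; true; false; T; if_then_else_)
  open import Data.Empty using (⊥-elim)
  open import Data.Fin.Subset using (_⊆_; ⊥; ⊤)
  import Data.Fin.Subset.Properties as Subset
  open import Data.List using (List; []; _∷_; map; filter; concatMap; length)
  open import Data.List.Membership.Propositional using (_∈_)
  open import Data.Nat using (zero; suc; _<_; _≤_; _∸_; _≡ᵇ_; _<ᵇ_; z≤n) renaming (_+_ to _+ℕ_; _*_ to _*ℕ_)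
  import Data.Nat.Properties as ℕ
  open import Data.Product using (_,_; proj₁)
  open import Data.Vec.Properties using (≡-dec)
  import Data.Bool.Properties
  import Relation.Binary.PropositionalEquality as ≡
  open ≡ using (_≡_; _≢_)
  open import Relation.Nullary using (¬_; Dec; yes; no)
  open import Relation.Binary.Reasoning.Setoid setoid
  import Data.Bool

  constₚ-decrFrom : ∀ p w → constₚ (ℤWords.decrFrom p w) ≋ decrFrom p w
  constₚ-decrFrom p []      = ≋-refl
  constₚ-decrFrom p (l ∷ w) with l <ᵇ p
  ... | true  = negₚ-cong (constₚ-decrFrom l w)
  ... | false = mk≋ λ where
      zero    → ≡.refl
      (suc k) → ≡.refl

  constₚ-chainSum-decr : ∀ a b → constₚ (ℤChains.chainSum ℤWords.decr a b) ≋ chainSum decr a b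
  constₚ-chainSum-decr a b = ≋-trans (constₚ-∑ (satChains a b) _) (∑-cong (satChains a b) λ G → decr≋ (labels lab G))
    where
    decr≋ : ∀ w → constₚ (ℤWords.decr w) ≋ decr w
    decr≋ []      = ≋-refl
    decr≋ (p ∷ w) = negₚ-cong (constₚ-decrFrom p w)

  χ≋ : ∀ {a b} → Flat a → Flat b → a ⊆ b → a ≢ b → χ a b ≋ (x-1 *ₚ chainSum valley a b)
  χ≋ {a} {b} flatA flatB a⊆b a≢b = begin
    χ a b
      ≡⟨ foldr-+-map (λ F → monoₚ (μ a F) (r b ∸ r F)) (interval a b) ⟩
    ∑[ F ∈ interval a b ] monoₚ (μ a F) (r b ∸ r F)
      ≈⟨ ∑-cong-∈ (interval a b) (λ F F∈ → ≋-trans (monoₚ-≋ (μ a F) (r b ∸ r F)) (*ₚ-congʳ _ (μ≋ F∈))) ⟩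
    ∑[ F ∈ interval a b ] (chainSum decr a F *ₚ (Xₚ ^ (r b ∸ r F)))
      ≈⟨ ∑-interval-decr flatA flatB a⊆b a≢b ⟩
    x-1 *ₚ chainSum valley a b
      ∎
    where
    μ≋ : ∀ {F} → F ∈ interval a b → constₚ (μ a F) ≋ chainSum decr a F
    μ≋ {F} F∈ = ≋-trans (≋-reflexive (≡.cong constₚ (μ≡chainSum-decr flatA (proj₁ (interval-sound a b F∈)))))
                       (constₚ-chainSum-decr a F)

  χ̄≋ : ∀ {a b} → Flat a → Flat b → a ⊆ b → a ≢ b → χ̄ a b ≋ chainSum valley a b
  χ̄≋ flatA flatB a⊆b a≢b = div-x-1-correct _ _ (χ≋ flatA flatB a⊆b a≢b)

  chainSum-valley-⊄ : ∀ y z → ¬ T (y ⊂ᵇ z) → chainSum valley y z ≋ []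
  chainSum-valley-⊄ y z = by-cases (≡-dec Data.Bool.Properties._≟_ y z) (y Subset.⊆? z)
    where
    by-cases : Dec (y ≡ z) → Dec (y ⊆ z) → ¬ T (y ⊂ᵇ z) → chainSum valley y z ≋ []
    by-cases (yes y≡z) _          _   = ≡.subst (λ z → chainSum valley y z ≋ []) y≡z (chainSum-refl valley y)
    by-cases (no y≢z)  (yes y⊆z) y⊄z = ⊥-elim (y⊄z (⊂ᵇ-complete y⊆z y≢z))
    by-cases (no _)    (no y⊈z)  _   = chainSum-⊈ valley y z y⊈z

  ∑-chainsFrom-unfold : ∀ {y} → Flat y → y ≢ ⊤ →
    (∀ {z} → z ∈ strictlyAbove y → ∑ (chainsFrom z) χ̄-chain ≋ chainSum valleys z ⊤) →
    ∑ (chainsFrom y) χ̄-chain ≋ ∑[ z ∈ strictlyAbove y ] (chainSum valley y z *ₚ chainSum valleys z ⊤)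
  ∑-chainsFrom-unfold {y} flat y≢⊤ above rewrite chainsFrom-≢⊤ flat y≢⊤ = begin
    ∑ (concatMap (λ z → map (y ∷_) (chainsFrom z)) (strictlyAbove y)) χ̄-chain
      ≈⟨ ∑-concatMap (λ z → map (y ∷_) (chainsFrom z)) (strictlyAbove y) χ̄-chain ⟩
    ∑[ z ∈ strictlyAbove y ] ∑ (map (y ∷_) (chainsFrom z)) χ̄-chain
      ≈⟨ ∑-cong-∈ (strictlyAbove y) (λ z z∈ → ≋-trans (≋-reflexive (∑-map (y ∷_) (chainsFrom z) χ̄-chain)) (first-step z∈)) ⟩
    ∑[ z ∈ strictlyAbove y ] (chainSum valley y z *ₚ chainSum valleys z ⊤)
      ∎
    where
    first-step : ∀ {z} → z ∈ strictlyAbove y →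
      ∑[ C ∈ chainsFrom z ] χ̄-chain (y ∷ C) ≋ (chainSum valley y z *ₚ chainSum valleys z ⊤)
    first-step {z} z∈ with flatZ , y⊆z , y≢z ← strictlyAbove-sound y z∈ = begin
      ∑[ C ∈ chainsFrom z ] χ̄-chain (y ∷ C)
        ≈⟨ ∑-cong-∈ (chainsFrom z) (λ C C∈ → ≋-reflexive (head C∈)) ⟩
      ∑[ C ∈ chainsFrom z ] (χ̄ y z *ₚ χ̄-chain C)
        ≈⟨ *-distribˡ-∑ (χ̄ y z) (chainsFrom z) χ̄-chain ⟨
      χ̄ y z *ₚ ∑ (chainsFrom z) χ̄-chain
        ≈⟨ CommutativeRing.*-cong commutativeRing (χ̄≋ flat flatZ y⊆z y≢z) (above z∈) ⟩
      chainSum valley y z *ₚ chainSum valleys z ⊤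
        ∎
      where
      head : ∀ {C} → C ∈ chainsFrom z → χ̄-chain (y ∷ C) ≡ (χ̄ y z *ₚ χ̄-chain C)
      head C∈ with _ , ≡.refl ← chainsFrom′-head (suc m) C∈ = ≡.refl

  ∑-strictlyAbove-valley⋆valleys : ∀ {y} → Flat y → y ≢ ⊤ →
    ∑[ z ∈ strictlyAbove y ] (chainSum valley y z *ₚ chainSum valleys z ⊤) ≋ chainSum valleys y ⊤
  ∑-strictlyAbove-valley⋆valleys {y} flat y≢⊤ = begin
    ∑[ z ∈ strictlyAbove y ] (chainSum valley y z *ₚ chainSum valleys z ⊤)
      ≈⟨ ∑-filter (y ⊂ᵇ_) flats _ ⟩
    ∑[ z ∈ flats ] (if y ⊂ᵇ z then chainSum valley y z *ₚ chainSum valleys z ⊤ else [])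
      ≈⟨ ∑-cong flats strictly ⟩
    ∑[ z ∈ flats ] (chainSum valley y z *ₚ chainSum valleys z ⊤)
      ≈⟨ chainSum-⋆ valley valleys y ⊤ flat ⟨
    chainSum (valley ⋆ valleys) y ⊤
      ≈⟨ chainSum-nonempty {valley ⋆ valleys} {valleys} y ⊤ y≢⊤ (λ p w → ≋-sym (valleys-⋆ p w)) ⟩
    chainSum valleys y ⊤
      ∎
    where
    strictly : ∀ z → (if y ⊂ᵇ z then chainSum valley y z *ₚ chainSum valleys z ⊤ else [])
                     ≋ (chainSum valley y z *ₚ chainSum valleys z ⊤)
    strictly z with y ⊂ᵇ z in y⊂z
    ... | true  = ≋-refl
    ... | false = ≋-sym (*ₚ-congʳ (chainSum valleys z ⊤) (chainSum-valley-⊄ y z λ t → ≡.subst T y⊂z t))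

  ∑-chainsFrom : ∀ {y} → Flat y → ∑ (chainsFrom y) χ̄-chain ≋ chainSum valleys y ⊤
  ∑-chainsFrom {y} flat = go (suc m) flat (ℕ.m≤n+m (suc m) (r y))
    where
    go : ∀ n {y} → Flat y → m < r y +ℕ n → ∑ (chainsFrom y) χ̄-chain ≋ chainSum valleys y ⊤
    go zero    {y} _    m< = ⊥-elim (m≮r+0 y m<)
    go (suc n) {y} flat m< = by-cases (≡-dec Data.Bool.Properties._≟_ y ⊤)
      where
      fuel : ∀ {z} → z ∈ strictlyAbove y → m < r z +ℕ n
      fuel z∈ with _ , y⊆z , y≢z ← strictlyAbove-sound y z∈ =
        ℕ.<-≤-trans (≡.subst (m <_) (ℕ.+-suc (r y) n) m<) (ℕ.+-monoˡ-≤ n (flat-rank-strict flat y⊆z y≢z))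
      by-cases : Dec (y ≡ ⊤) → ∑ (chainsFrom y) χ̄-chain ≋ chainSum valleys y ⊤
      by-cases (yes y≡⊤) rewrite chainsFrom-⊤ y≡⊤ | y≡⊤ = ≋-sym (chainSum-refl valleys ⊤)
      by-cases (no y≢⊤)  = ≋-trans
        (∑-chainsFrom-unfold flat y≢⊤ λ z∈ → go n (proj₁ (strictlyAbove-sound y z∈)) (fuel z∈))
        (∑-strictlyAbove-valley⋆valleys flat y≢⊤)

  ∑-chainsTo1 : ∑[ C ∈ chainsTo1 ] ((Xₚ ^ₚ firstRank C) *ₚ χ̄-chain C) ≋ chainSum (incr ⋆ valleys) ⊥ ⊤
  ∑-chainsTo1 = begin
    ∑[ C ∈ chainsTo1 ] ((Xₚ ^ₚ firstRank C) *ₚ χ̄-chain C)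
      ≈⟨ ∑-concatMap chainsFrom flats _ ⟩
    ∑[ y ∈ flats ] ∑[ C ∈ chainsFrom y ] ((Xₚ ^ₚ firstRank C) *ₚ χ̄-chain C)
      ≈⟨ ∑-cong-∈ flats (λ y y∈ → through (flats-sound y∈)) ⟩
    ∑[ y ∈ flats ] (chainSum incr ⊥ y *ₚ chainSum valleys y ⊤)
      ≈⟨ chainSum-⋆ incr valleys ⊥ ⊤ (⊥-flat loopless) ⟨
    chainSum (incr ⋆ valleys) ⊥ ⊤
      ∎
    where
    through : ∀ {y} → Flat y →
      ∑[ C ∈ chainsFrom y ] ((Xₚ ^ₚ firstRank C) *ₚ χ̄-chain C) ≋ (chainSum incr ⊥ y *ₚ chainSum valleys y ⊤)
    through {y} flat = begin
      ∑[ C ∈ chainsFrom y ] ((Xₚ ^ₚ firstRank C) *ₚ χ̄-chain C)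
        ≈⟨ ∑-cong-∈ (chainsFrom y) (λ C C∈ → ≋-reflexive (head C∈)) ⟩
      ∑[ C ∈ chainsFrom y ] ((Xₚ ^ r y) *ₚ χ̄-chain C)
        ≈⟨ *-distribˡ-∑ (Xₚ ^ r y) (chainsFrom y) χ̄-chain ⟨
      (Xₚ ^ r y) *ₚ ∑ (chainsFrom y) χ̄-chain
        ≈⟨ CommutativeRing.*-cong commutativeRing rank≋ (∑-chainsFrom flat) ⟩
      chainSum incr ⊥ y *ₚ chainSum valleys y ⊤
        ∎
      where
      head : ∀ {C} → C ∈ chainsFrom y → ((Xₚ ^ₚ firstRank C) *ₚ χ̄-chain C) ≡ ((Xₚ ^ r y) *ₚ χ̄-chain C)
      head {C} C∈ with _ , ≡.refl ← chainsFrom′-head (suc m) C∈ = ≡.cong (_*ₚ χ̄-chain C) (^ₚ≡^ Xₚ (r y))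
      rank≋ : (Xₚ ^ r y) ≋ chainSum incr ⊥ y
      rank≋ = ≋-sym (≋-trans (chainSum-incr (⊥-flat loopless) flat (Subset.⊆-min y))
                            (≋-reflexive (≡.cong (λ k → Xₚ ^ (r y ∸ k)) r⊥≡0)))

  rhs-≋ : rhs lab ≋ chainSum isolatedDescentWeight ⊥ ⊤
  rhs-≋ = begin
    rhs lab
      ≡⟨ foldr-+-map summand (filter (λ F → Data.Bool.T? (DesIsolated lab F)) maxChains) ⟩
    ∑ (filter (λ F → Data.Bool.T? (DesIsolated lab F)) maxChains) summand
      ≈⟨ ∑-filter (DesIsolated lab) maxChains summand ⟩
    ∑[ G ∈ maxChains ] (if DesIsolated lab G then summand G else [])
      ≈⟨ ∑-cong-∈ maxChains (λ G G∈ → if-cong (DesIsolated lab G) (≋-reflexive (summand≡ G∈))) ⟩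
    chainSum isolatedDescentWeight ⊥ ⊤
      ∎
    where
    summand : List (Subset m) → Poly
    summand G = (Xₚ ^ₚ des lab G) *ₚ (X+1ₚ ^ₚ (rank M ∸ 2 *ℕ des lab G))
    summand≡ : ∀ {G} → G ∈ maxChains →
      summand G ≡ ((Xₚ ^ des lab G) *ₚ (X+1ₚ ^ (length (labels lab G) ∸ 2 *ℕ des lab G)))
    summand≡ {G} G∈ = ≡.cong₂ _*ₚ_ (^ₚ≡^ Xₚ (des lab G))
      (≡.trans (^ₚ≡^ X+1ₚ (rank M ∸ 2 *ℕ des lab G)) (≡.cong (λ n → X+1ₚ ^ (n ∸ 2 *ℕ des lab G)) rank≡length))
      where
      rank≡length : rank M ≡ length (labels lab G)
      rank≡length = ≡.trans (≡.sym (SatChain-length lab (satChains-sound G∈)))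
                            (≡.trans (≡.cong (length (labels lab G) +ℕ_) r⊥≡0) (ℕ.+-identityʳ _))

  rank0⇒⊥≡⊤ : rank M ≡ 0 → ⊥ ≡ ⊤
  rank0⇒⊥≡⊤ rank≡0 with ≡-dec Data.Bool.Properties._≟_ ⊥ ⊤
  ... | yes ⊥≡⊤ = ⊥≡⊤
  ... | no  ⊥≢⊤ = ⊥-elim (ℕ.<⇒≱ (flat-rank-strict (⊥-flat loopless) (Subset.⊆-min ⊤) ⊥≢⊤)
                                (≡.subst (_≤ r ⊥) (≡.sym rank≡0) z≤n))

  augChow-≋ : augChow ≋ chainSum (incr ⋆ valleys) ⊥ ⊤
  augChow-≋ = by-rank (rank M ≡ᵇ 0) ≡.refl
    where
    by-rank : ∀ b → (rank M ≡ᵇ 0) ≡ b →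
      (if b then oneₚ else sumₚ (map (λ C → (Xₚ ^ₚ firstRank C) *ₚ χ̄-chain C) chainsTo1))
      ≋ chainSum (incr ⋆ valleys) ⊥ ⊤
    by-rank true  rank0 rewrite ≡.sym (rank0⇒⊥≡⊤ (ℕ.≡ᵇ⇒≡ (rank M) 0 (≡.subst T (≡.sym rank0) _))) =
      ≋-sym (≋-trans (chainSum-refl (incr ⋆ valleys) ⊥) (*ₚ-identityˡ oneₚ))
    by-rank false _ = ≋-trans (≋-reflexive (foldr-+-map _ chainsTo1)) ∑-chainsTo1

theorem1p2 : (m : ℕ) (M : Matroid m) → Loopless M →
    (lab : Subset m → Subset m → ℕ) → LatticeOfFlats.IsRLabeling M lab →
    LatticeOfFlats.augChow M ≈ₚ LatticeOfFlats.rhs M lab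
theorem1p2 m M loopless lab isR = PolynomialRing.coeff-≡ (begin
  augChow                             ≈⟨ augChow-≋ ⟩
  chainSum (incr ⋆ valleys) ⊥ ⊤       ≈⟨ ∑-cong maxChains (λ G → incr⋆valleys (labels lab G)) ⟩
  chainSum isolatedDescentWeight ⊥ ⊤  ≈⟨ rhs-≋ ⟨
  rhs lab                             ∎)
  where
  open import Data.Fin.Subset using (⊥; ⊤)
  open LatticeOfFlats M using (augChow; rhs; labels; maxChains)
  open PolynomialRing using (commutativeRing)
  open import Relation.Binary.Reasoning.Setoid (CommutativeRing.setoid commutativeRing)
  open ListSums commutativeRing using (∑-cong; _⋆_)
  open ChainSums M lab commutativeRing using (chainSum)
  open LabelWords M commutativeRing Xₚ using (incr; valleys; isolatedDescentWeight; incr⋆valleys)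
  open AugmentedChow M loopless lab isR using (augChow-≋; rhs-≋)
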